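{- Let $p$ be an odd prime, $K_p=GSp(4,\mathbb Z_p)$ and $I_p$ its Iwahori subgroup. Let $Y=\{0,1,\dots,p-1\}$ and $V=Y\cup\{\infty\}$. Let $\mathcal S$ be the set consisting of: the matrices $A_x^y=U_xJZ_y$ for $x\in Y^3$, $y\in V$; the matrices $B_x^y=JU_xJZ_y$ for $x=(n,q,r)\in Y^3$ with $q^2-nr\equiv0\pmod p$ and $y\in V$; and the matrices $D_\lambda^y$ for $\lambda,y\in V$. Then $\mathcal S$ (which has $(p+1)^2(p^2+1)$ elements) is a complete set of representatives for the cosets $K_p/I_p$.
   Context: $J=\begin{pmatrix}0&1_2\\-1_2&0\end{pmatrix}$, $GSp(4)=\{g:g^TJg=\mu(g)J\}$. $I_p=\{k\in K_p:k\equiv\begin{pmatrix}\ast&0&\ast&\ast\\\ast&\ast&\ast&\ast\\0&0&\ast&\ast\\0&0&0&\ast\end{pmatrix}\bmod p\}$. For $x=(n,q,r)$, $U_x=\begin{pmatrix}1&0&n&q\\0&1&q&r\\0&0&1&0\\0&0&0&1\end{pmatrix}$. For $y\in\mathbb Z_p$, $Z_y=\begin{pmatrix}1&y&0&0\\0&1&0&0\\0&0&1&0\\0&0&-y&1\end{pmatrix}$, and $Z_\infty=\begin{pmatrix}0&1&0&0\\1&0&0&0\\0&0&0&1\\0&0&1&0\end{pmatrix}$. For $y\in V$: $D_\lambda^y=\begin{pmatrix}-\lambda&0&0&1\\1&0&0&\lambda^{ -1}\\0&1&\lambda^{ -1}&0\\0&\lambda&-1&0\end{pmatrix}Z_y$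 if $\lambda\in Y\setminus\{0\}$; $D_0^y=\begin{pmatrix}0&0&0&1\\-1&0&0&0\\0&1&0&0\\0&0&1&0\end{pmatrix}Z_y$; $D_\infty^y=\begin{pmatrix}-1&0&0&0\\0&0&0&1\\0&0&1&0\\0&1&0&0\end{pmatrix}Z_y$. -}

module Defs where

open import Data.Nat as ℕ using (ℕ; zero; suc; _^_)
open import Data.Integer using (ℤ; +_; -_; _+_; _-_; _*_; 0ℤ; 1ℤ; -1ℤ)
open import Data.Integer.Divisibility using (_∣_)
open import Data.Fin using (Fin; zero; suc; toℕ)
open import Data.Maybe using (Maybe; just; nothing)
open import Data.Product using (Σ; _×_)
open import Data.Unit using (⊤)

-- p-adic integers Z_p as the inverse limit of Z/p^k Z.
-- An element is a sequence x : ℕ → ℤ, where x k represents a residue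
-- mod p^k, subject to compatibility  x (k+1) ≡ x k  (mod p^k).

Seq : Set
Seq = ℕ → ℤ

IsZp : ℕ → Seq → Set
IsZp p x = ∀ k → (+ (p ^ k)) ∣ (x (suc k) - x k)

_≈[_]_ : Seq → ℕ → Seq → Set
x ≈[ p ] y = ∀ k → (+ (p ^ k)) ∣ (x k - y k)

cst : ℤ → Seq
cst c _ = c

nat : ℕ → Seq
nat n = cst (+ n)

_⊕_ _⊗_ : Seq → Seq → Seq
(x ⊕ y) k = x k + y k
(x ⊗ y) k = x k * y k

neg : Seq → Seq
neg x k = - x k

ZeroModP : ℕ → Seq → Set
ZeroModP p x = (+ p) ∣ x 1

IsUnit : ℕ → Seq → Set
IsUnit p μ = Σ Seq (λ ν → IsZp p ν × ((μ ⊗ ν) ≈[ p ] cst 1ℤ))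

Mat : Set
Mat = Fin 4 → Fin 4 → Seq

mat : Seq → Seq → Seq → Seq →
      Seq → Seq → Seq → Seq →
      Seq → Seq → Seq → Seq →
      Seq → Seq → Seq → Seq → Mat
mat a _ _ _ _ _ _ _ _ _ _ _ _ _ _ _ zero zero = a
mat _ a _ _ _ _ _ _ _ _ _ _ _ _ _ _ zero (suc zero) = a
mat _ _ a _ _ _ _ _ _ _ _ _ _ _ _ _ zero (suc (suc zero)) = a
mat _ _ _ a _ _ _ _ _ _ _ _ _ _ _ _ zero (suc (suc (suc zero))) = a
mat _ _ _ _ a _ _ _ _ _ _ _ _ _ _ _ (suc zero) zero = a
mat _ _ _ _ _ a _ _ _ _ _ _ _ _ _ _ (suc zero) (suc zero) = a
mat _ _ _ _ _ _ a _ _ _ _ _ _ _ _ _ (suc zero) (suc (suc zero)) = a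
mat _ _ _ _ _ _ _ a _ _ _ _ _ _ _ _ (suc zero) (suc (suc (suc zero))) = a
mat _ _ _ _ _ _ _ _ a _ _ _ _ _ _ _ (suc (suc zero)) zero = a
mat _ _ _ _ _ _ _ _ _ a _ _ _ _ _ _ (suc (suc zero)) (suc zero) = a
mat _ _ _ _ _ _ _ _ _ _ a _ _ _ _ _ (suc (suc zero)) (suc (suc zero)) = a
mat _ _ _ _ _ _ _ _ _ _ _ a _ _ _ _ (suc (suc zero)) (suc (suc (suc zero))) = a
mat _ _ _ _ _ _ _ _ _ _ _ _ a _ _ _ (suc (suc (suc zero))) zero = a
mat _ _ _ _ _ _ _ _ _ _ _ _ _ a _ _ (suc (suc (suc zero))) (suc zero) = a
mat _ _ _ _ _ _ _ _ _ _ _ _ _ _ a _ (suc (suc (suc zero))) (suc (suc zero)) = a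
mat _ _ _ _ _ _ _ _ _ _ _ _ _ _ _ a (suc (suc (suc zero))) (suc (suc (suc zero))) = a

f0 f1 f2 f3 : Fin 4
f0 = zero
f1 = suc zero
f2 = suc (suc zero)
f3 = suc (suc (suc zero))

infixl 7 _·_
_·_ : Mat → Mat → Mat
(M · N) i j = (((M i f0 ⊗ N f0 j) ⊕ (M i f1 ⊗ N f1 j)) ⊕ (M i f2 ⊗ N f2 j)) ⊕ (M i f3 ⊗ N f3 j)

transpose : Mat → Mat
transpose M i j = M j i

scale : Seq → Mat → Mat
scale μ M i j = μ ⊗ M i j

MatEq : ℕ → Mat → Mat → Set
MatEq p M N = ∀ i j → M i j ≈[ p ] N i j

IsZpMat : ℕ → Mat → Set
IsZpMat p M = ∀ i j → IsZp p (M i j)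

O I1 M1 : Seq
O = cst 0ℤ
I1 = cst 1ℤ
M1 = cst -1ℤ

Jm : Mat
Jm = mat O  O  I1 O
         O  O  O  I1
         M1 O  O  O
         O  M1 O  O

InK : ℕ → Mat → Set
InK p g = IsZpMat p g ×
          Σ Seq (λ μ → IsZp p μ × IsUnit p μ × MatEq p (transpose g · Jm · g) (scale μ Jm))

InI : ℕ → Mat → Set
InI p g = InK p g ×
          (ZeroModP p (g f0 f1) × ZeroModP p (g f2 f0) × ZeroModP p (g f2 f1) ×
           ZeroModP p (g f3 f0) × ZeroModP p (g f3 f1) × ZeroModP p (g f3 f2))

-- The representatives.  Y = Fin p (read via toℕ), V = Maybe (Fin p)
-- with nothing = ∞.

V : ℕ → Set
V p = Maybe (Fin p)

fn : {p : ℕ} → Fin p → Seq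
fn a = nat (toℕ a)

U : {p : ℕ} → Fin p → Fin p → Fin p → Mat
U n q r = mat I1 O  (fn n) (fn q)
              O  I1 (fn q) (fn r)
              O  O  I1     O
              O  O  O      I1

Z : {p : ℕ} → V p → Mat
Z (just y) = mat I1 (fn y) O O
                 O  I1     O O
                 O  O      I1 O
                 O  O      (neg (fn y)) I1
Z nothing = mat O  I1 O  O
                I1 O  O  O
                O  O  O  I1
                O  O  I1 O

-- D_λ (without the factor Z_y); inv λ stands for λ⁻¹ ∈ Z_p.
Dl : {p : ℕ} → (inv : ℕ → Seq) → V p → Mat
Dl inv (just zero) = mat O  O  O  I1
                         M1 O  O  O
                         O  I1 O  O
                         O  O  I1 O
Dl inv (just (suc l)) =
  let λ' = nat (suc (toℕ l)) ; λi = inv (suc (toℕ l)) in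
  mat (neg λ') O  O  I1
      I1       O  O  λi
      O        I1 λi O
      O        λ' M1 O
Dl inv nothing = mat M1 O  O  O
                     O  O  O  I1
                     O  O  I1 O
                     O  I1 O  O

-- Index set of 𝒮 (B-indices additionally subject to ValidIdx)
data Idx (p : ℕ) : Set where
  A : (n q r : Fin p) → V p → Idx p
  B : (n q r : Fin p) → V p → Idx p
  D : (λ' y : V p) → Idx p

ValidIdx : {p : ℕ} → Idx p → Set
ValidIdx (A _ _ _ _) = ⊤
ValidIdx {p} (B n q r _) = (+ p) ∣ ((+ toℕ q) * (+ toℕ q) - (+ toℕ n) * (+ toℕ r))
ValidIdx (D _ _) = ⊤

rep : {p : ℕ} → (inv : ℕ → Seq) → Idx p → Mat
rep inv (A n q r y) = U n q r · Jm · Z y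
rep inv (B n q r y) = Jm · U n q r · Jm · Z y
rep inv (D l y) = Dl inv l · Z y

InCoset : ℕ → Mat → Mat → Set
InCoset p g s = Σ Mat (λ h → InI p h × MatEq p g (s · h))

-- The coset g I_p only depends on the flag ⟨g e₁⟩ ⊂ ⟨g e₀, g e₁⟩ of 𝔽ₚ⁴ cut out by the first two
-- columns of g: an element of K_p whose columns 0 and 1 are congruent to combinations of e₀, e₁
-- and of e₁ lies in I_p, the entry (3,2) being forced to vanish by the symplectic relations.
-- Each representative is a product of factors lying in K_p, and its flag is explicit. The 2 × 2
-- minors of the top and bottom halves of a flag, which a change of basis multiplies by a unit,
-- separate the families: the bottom minor is a unit for A, the top one for B (whose bottom minor
-- is ±(q² − nr)), and both vanish for D. Within a family the parameters are read off row by row,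
-- B being reduced to A by J. Conversely, the minors of the flag of g select the family, Cramer's
-- rule (A, B) or a kernel vector of a singular 2 × 2 block (D) supplies n, q, r or λ, and y is
-- chosen so that Z_y moves the second column onto the line of the flag.

module Submission where

open import Defs
open import Data.Nat using (ℕ; _≤_; _<_)
open import Data.Nat.Divisibility using (_∣_)
open import Data.Nat.Primality using (Prime)
open import Data.Product using (Σ; _×_)
open import Relation.Nullary using (¬_)
open import Relation.Binary.PropositionalEquality using (_≡_)

open import Data.Bool using (T)
open import Data.Empty using (⊥; ⊥-elim)
open import Data.Fin using (Fin; zero; suc; toℕ; fromℕ<)
import Data.Fin.Properties as FP
open import Data.Integer as ℤ using (ℤ; +_; -_; _+_; _-_; _*_; 0ℤ; 1ℤ; -1ℤ)
open import Data.Integer.DivMod using (_%ℕ_; _/ℕ_; n%ℕd<d; a≡a%ℕn+[a/ℕn]*n)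
open import Data.Integer.Divisibility.Signed using (divides; ∣ᵤ⇒∣; ∣⇒∣ᵤ; ∣m∣n⇒∣m+n; ∣n⇒∣m*n) renaming (_∣_ to _∣ˢ_)
import Data.Integer.Properties as ℤP
open import Data.Integer.Solver using (module +-*-Solver)
open +-*-Solver using (Polynomial; op; con; var; _:^_; :-_; _:+_; _:*_; _:-_; ⟦_⟧; normalise; _≟N_; ⟦_⟧N-cong; correct)
open import Data.Integer.Tactic.RingSolver using (solve-∀)
open import Data.Maybe using (Maybe; just; nothing; is-just; to-witness-T)
import Data.Maybe as Maybe
import Data.Nat as ℕ
open import Data.Nat using (zero; suc; NonZero; z≤n; s≤s)
open import Data.Nat.Coprimality using (prime⇒coprime; coprime-Bézout)
import Data.Nat.Divisibility as ℕD
import Data.Nat.GCD as GCD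
open import Data.Nat.Primality using (prime⇒nonZero; prime⇒nonTrivial; euclidsLemma)
import Data.Nat.Properties as ℕP
open import Data.Product using (_,_; proj₁; proj₂)
open import Data.Sum using (_⊎_; inj₁; inj₂; [_,_])
open import Data.Unit using (tt)
open import Data.Vec using (Vec; _∷_; []; lookup)
open import Relation.Binary.Bundles using (Setoid)
open import Relation.Binary.PropositionalEquality using (refl; sym; trans; cong; cong₂; subst)
import Relation.Binary.Reasoning.Setoid as SetoidReasoning
open import Relation.Nullary using (yes; no)

infixl 6 _⊞_
infix 7 _⊠_

_⊞_ : ∀ {m a b} → m ∣ˢ a → m ∣ˢ b → m ∣ˢ a + b
_⊞_ = ∣m∣n⇒∣m+n

_⊠_ : ∀ {m a} c → m ∣ˢ a → m ∣ˢ c * a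
c ⊠ d = ∣n⇒∣m*n c d

∣0 : ∀ {m} → m ∣ˢ 0ℤ
∣0 {m} = divides 0ℤ (sym (ℤP.*-zeroˡ m))

∣-by : ∀ {m a b} → a ≡ b → m ∣ˢ b → m ∣ˢ a
∣-by eq = subst (_ ∣ˢ_) (sym eq)

-- ℤₚ and 4 × 4 matrices over it

module PAdic (p : ℕ) where

  pᵏ : ℕ → ℤ
  pᵏ k = + (p ℕ.^ k)

  -- Records rather than bare Π-types, so that the compared sequences can be inferred.
  infix 4 _≃_
  record _≃_ (x y : Seq) : Set where
    constructor mk≃
    field ≃-divides : ∀ k → pᵏ k ∣ˢ (x k - y k)
  open _≃_ public

  record Integral (x : Seq) : Set where
    constructor mkIntegral
    field compatible : ∀ k → pᵏ k ∣ˢ (x (suc k) - x k)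
  open Integral public

  ≃⇒≈ : ∀ {x y} → x ≃ y → x ≈[ p ] y
  ≃⇒≈ (mk≃ h) k = ∣⇒∣ᵤ (h k)

  ≈⇒≃ : ∀ {x y} → x ≈[ p ] y → x ≃ y
  ≈⇒≃ h = mk≃ λ k → ∣ᵤ⇒∣ (h k)

  Integral⇒IsZp : ∀ {x} → Integral x → IsZp p x
  Integral⇒IsZp (mkIntegral h) k = ∣⇒∣ᵤ (h k)

  IsZp⇒Integral : ∀ {x} → IsZp p x → Integral x
  IsZp⇒Integral h = mkIntegral λ k → ∣ᵤ⇒∣ (h k)

  ≃-pointwise : ∀ {x y} → (∀ k → x k ≡ y k) → x ≃ y
  ≃-pointwise {x} {y} e = mk≃ λ k → ∣-by (trans (cong (_- y k) (e k)) (ℤP.+-inverseʳ (y k))) ∣0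

  ≃-refl : ∀ {x} → x ≃ x
  ≃-refl = ≃-pointwise λ _ → refl

  ≃-sym : ∀ {x y} → x ≃ y → y ≃ x
  ≃-sym {x} {y} (mk≃ h) = mk≃ λ k → ∣-by (swap (x k) (y k)) (-1ℤ ⊠ h k)
    where
    swap : ∀ a b → b - a ≡ -1ℤ * (a - b)
    swap = solve-∀

  ≃-trans : ∀ {x y z} → x ≃ y → y ≃ z → x ≃ z
  ≃-trans {x} {y} {z} (mk≃ h₁) (mk≃ h₂) = mk≃ λ k → ∣-by (split (x k) (y k) (z k)) (h₁ k ⊞ h₂ k)
    where
    split : ∀ a b c → a - c ≡ (a - b) + (b - c)
    split = solve-∀

  ⊕-cong : ∀ {x x′ y y′} → x ≃ x′ → y ≃ y′ → (x ⊕ y) ≃ (x′ ⊕ y′)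
  ⊕-cong {x} {x′} {y} {y′} (mk≃ h₁) (mk≃ h₂) =
    mk≃ λ k → ∣-by (split (x k) (x′ k) (y k) (y′ k)) (h₁ k ⊞ h₂ k)
    where
    split : ∀ a a′ b b′ → (a + b) - (a′ + b′) ≡ (a - a′) + (b - b′)
    split = solve-∀

  ⊗-cong : ∀ {x x′ y y′} → x ≃ x′ → y ≃ y′ → (x ⊗ y) ≃ (x′ ⊗ y′)
  ⊗-cong {x} {x′} {y} {y′} (mk≃ h₁) (mk≃ h₂) =
    mk≃ λ k → ∣-by (split (x k) (x′ k) (y k) (y′ k)) (y k ⊠ h₁ k ⊞ x′ k ⊠ h₂ k)
    where
    split : ∀ a a′ b b′ → a * b - a′ * b′ ≡ b * (a - a′) + a′ * (b - b′)
    split = solve-∀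

  cst-integral : ∀ c → Integral (cst c)
  cst-integral c = mkIntegral λ _ → ∣-by (ℤP.+-inverseʳ c) ∣0

  Integral-pointwise : ∀ {x y} → (∀ k → x k ≡ y k) → Integral x → Integral y
  Integral-pointwise e (mkIntegral h) = mkIntegral λ k → subst (_ ∣ˢ_) (cong₂ _-_ (e (suc k)) (e k)) (h k)

  ⊕-integral : ∀ {x y} → Integral x → Integral y → Integral (x ⊕ y)
  ⊕-integral {x} {y} (mkIntegral h₁) (mkIntegral h₂) =
    mkIntegral λ k → ∣-by (split (x k) (x (suc k)) (y k) (y (suc k))) (h₁ k ⊞ h₂ k)
    where
    split : ∀ a a′ b b′ → (a′ + b′) - (a + b) ≡ (a′ - a) + (b′ - b)
    split = solve-∀

  ⊗-integral : ∀ {x y} → Integral x → Integral y → Integral (x ⊗ y)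
  ⊗-integral {x} {y} (mkIntegral h₁) (mkIntegral h₂) =
    mkIntegral λ k → ∣-by (split (x k) (x (suc k)) (y k) (y (suc k))) (y (suc k) ⊠ h₁ k ⊞ x k ⊠ h₂ k)
    where
    split : ∀ a a′ b b′ → a′ * b′ - a * b ≡ b′ * (a′ - a) + a * (b′ - b)
    split = solve-∀

  neg-integral : ∀ {x} → Integral x → Integral (neg x)
  neg-integral {x} (mkIntegral h) = mkIntegral λ k → ∣-by (split (x k) (x (suc k))) (-1ℤ ⊠ h k)
    where
    split : ∀ a a′ → (- a′) - (- a) ≡ -1ℤ * (a′ - a)
    split = solve-∀

I₄ : Mat
I₄ = mat I1 O  O  O
         O  I1 O  O
         O  O  I1 O
         O  O  O  I1

infix 4 _≐_
_≐_ : Mat → Mat → Set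
M ≐ N = ∀ i j k → M i j k ≡ N i j k

·-assoc : ∀ M N Q → (M · N) · Q ≐ M · (N · Q)
·-assoc M N Q i j k = expand (M i f0 k) (M i f1 k) (M i f2 k) (M i f3 k)
  (N f0 f0 k) (N f0 f1 k) (N f0 f2 k) (N f0 f3 k) (N f1 f0 k) (N f1 f1 k) (N f1 f2 k) (N f1 f3 k)
  (N f2 f0 k) (N f2 f1 k) (N f2 f2 k) (N f2 f3 k) (N f3 f0 k) (N f3 f1 k) (N f3 f2 k) (N f3 f3 k)
  (Q f0 j k) (Q f1 j k) (Q f2 j k) (Q f3 j k)
  where
  expand : ∀ a0 a1 a2 a3 b00 b01 b02 b03 b10 b11 b12 b13 b20 b21 b22 b23 b30 b31 b32 b33 c0 c1 c2 c3 →
    (a0 * b00 + a1 * b10 + a2 * b20 + a3 * b30) * c0 + (a0 * b01 + a1 * b11 + a2 * b21 + a3 * b31) * c1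
      + (a0 * b02 + a1 * b12 + a2 * b22 + a3 * b32) * c2 + (a0 * b03 + a1 * b13 + a2 * b23 + a3 * b33) * c3
    ≡ a0 * (b00 * c0 + b01 * c1 + b02 * c2 + b03 * c3) + a1 * (b10 * c0 + b11 * c1 + b12 * c2 + b13 * c3)
      + a2 * (b20 * c0 + b21 * c1 + b22 * c2 + b23 * c3) + a3 * (b30 * c0 + b31 * c1 + b32 * c2 + b33 * c3)
  expand = solve-∀

transpose-· : ∀ M N → transpose (M · N) ≐ transpose N · transpose M
transpose-· M N i j k =
  commute (M j f0 k) (M j f1 k) (M j f2 k) (M j f3 k) (N f0 i k) (N f1 i k) (N f2 i k) (N f3 i k)
  where
  commute : ∀ m0 m1 m2 m3 n0 n1 n2 n3 →
    m0 * n0 + m1 * n1 + m2 * n2 + m3 * n3 ≡ n0 * m0 + n1 * m1 + n2 * m2 + n3 * m3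
  commute = solve-∀

scale-·ˡ : ∀ a M N → scale a M · N ≐ scale a (M · N)
scale-·ˡ a M N i j k =
  factor (a k) (M i f0 k) (M i f1 k) (M i f2 k) (M i f3 k) (N f0 j k) (N f1 j k) (N f2 j k) (N f3 j k)
  where
  factor : ∀ a m0 m1 m2 m3 n0 n1 n2 n3 →
    a * m0 * n0 + a * m1 * n1 + a * m2 * n2 + a * m3 * n3 ≡ a * (m0 * n0 + m1 * n1 + m2 * n2 + m3 * n3)
  factor = solve-∀

scale-·ʳ : ∀ a M N → M · scale a N ≐ scale a (M · N)
scale-·ʳ a M N i j k =
  factor (a k) (M i f0 k) (M i f1 k) (M i f2 k) (M i f3 k) (N f0 j k) (N f1 j k) (N f2 j k) (N f3 j k)
  where
  factor : ∀ a m0 m1 m2 m3 n0 n1 n2 n3 →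
    m0 * (a * n0) + m1 * (a * n1) + m2 * (a * n2) + m3 * (a * n3) ≡ a * (m0 * n0 + m1 * n1 + m2 * n2 + m3 * n3)
  factor = solve-∀

scale-scale : ∀ a b M → scale a (scale b M) ≐ scale (b ⊗ a) M
scale-scale a b M i j k = trans (sym (ℤP.*-assoc (a k) (b k) (M i j k))) (cong (_* M i j k) (ℤP.*-comm (a k) (b k)))

·-identityˡ : ∀ M → I₄ · M ≐ M
·-identityˡ M zero j k = row₀ (M f0 j k) (M f1 j k) (M f2 j k) (M f3 j k)
  where row₀ : ∀ a b c d → 1ℤ * a + 0ℤ * b + 0ℤ * c + 0ℤ * d ≡ a
        row₀ = solve-∀
·-identityˡ M (suc zero) j k = row₁ (M f0 j k) (M f1 j k) (M f2 j k) (M f3 j k)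
  where row₁ : ∀ a b c d → 0ℤ * a + 1ℤ * b + 0ℤ * c + 0ℤ * d ≡ b
        row₁ = solve-∀
·-identityˡ M (suc (suc zero)) j k = row₂ (M f0 j k) (M f1 j k) (M f2 j k) (M f3 j k)
  where row₂ : ∀ a b c d → 0ℤ * a + 0ℤ * b + 1ℤ * c + 0ℤ * d ≡ c
        row₂ = solve-∀
·-identityˡ M (suc (suc (suc zero))) j k = row₃ (M f0 j k) (M f1 j k) (M f2 j k) (M f3 j k)
  where row₃ : ∀ a b c d → 0ℤ * a + 0ℤ * b + 0ℤ * c + 1ℤ * d ≡ d
        row₃ = solve-∀

module PAdicMatrices (p : ℕ) where
  open PAdic p

  infix 4 _≈ₘ_
  record _≈ₘ_ (M N : Mat) : Set where
    constructor mk≈ₘ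
    field entry-≃ : ∀ i j → M i j ≃ N i j
  open _≈ₘ_ public

  record IntegralMatrix (M : Mat) : Set where
    constructor mkIntegralMatrix
    field entry-integral : ∀ i j → Integral (M i j)
  open IntegralMatrix public

  ≐⇒≈ₘ : ∀ {M N} → M ≐ N → M ≈ₘ N
  ≐⇒≈ₘ e = mk≈ₘ λ i j → ≃-pointwise (e i j)

  ≈ₘ-setoid : Setoid _ _
  ≈ₘ-setoid = record
    { Carrier = Mat
    ; _≈_ = _≈ₘ_
    ; isEquivalence = record
      { refl = mk≈ₘ λ _ _ → ≃-refl
      ; sym = λ (mk≈ₘ h) → mk≈ₘ λ i j → ≃-sym (h i j)
      ; trans = λ (mk≈ₘ h₁) (mk≈ₘ h₂) → mk≈ₘ λ i j → ≃-trans (h₁ i j) (h₂ i j)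
      }
    }

  open Setoid ≈ₘ-setoid public using () renaming (refl to ≈ₘ-refl; sym to ≈ₘ-sym; trans to ≈ₘ-trans)

  ·-cong : ∀ {M M′ N N′} → M ≈ₘ M′ → N ≈ₘ N′ → M · N ≈ₘ M′ · N′
  ·-cong (mk≈ₘ h₁) (mk≈ₘ h₂) = mk≈ₘ λ i j →
    ⊕-cong (⊕-cong (⊕-cong (⊗-cong (h₁ i f0) (h₂ f0 j)) (⊗-cong (h₁ i f1) (h₂ f1 j)))
                   (⊗-cong (h₁ i f2) (h₂ f2 j)))
           (⊗-cong (h₁ i f3) (h₂ f3 j))

  ·-congˡ : ∀ {M M′} N → M ≈ₘ M′ → M · N ≈ₘ M′ · N
  ·-congˡ N h = ·-cong h (≈ₘ-refl {N})

  ·-congʳ : ∀ M {N N′} → N ≈ₘ N′ → M · N ≈ₘ M · N′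
  ·-congʳ M h = ·-cong (≈ₘ-refl {M}) h

  transpose-cong : ∀ {M N} → M ≈ₘ N → transpose M ≈ₘ transpose N
  transpose-cong (mk≈ₘ h) = mk≈ₘ λ i j → h j i

  scale-congʳ : ∀ a {M N} → M ≈ₘ N → scale a M ≈ₘ scale a N
  scale-congʳ a (mk≈ₘ h) = mk≈ₘ λ i j → ⊗-cong (≃-refl {a}) (h i j)

  ·-integral : ∀ {M N} → IntegralMatrix M → IntegralMatrix N → IntegralMatrix (M · N)
  ·-integral (mkIntegralMatrix h₁) (mkIntegralMatrix h₂) = mkIntegralMatrix λ i j →
    ⊕-integral (⊕-integral (⊕-integral (⊗-integral (h₁ i f0) (h₂ f0 j)) (⊗-integral (h₁ i f1) (h₂ f1 j)))
                           (⊗-integral (h₁ i f2) (h₂ f2 j)))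
               (⊗-integral (h₁ i f3) (h₂ f3 j))

  record Unit (μ : Seq) : Set where
    constructor mkUnit
    field
      integral : Integral μ
      inverse : Seq
      inverse-integral : Integral inverse
      inverse-eq : μ ⊗ inverse ≃ I1

  Unit-⊗ : ∀ {a b} → Unit a → Unit b → Unit (a ⊗ b)
  Unit-⊗ {a} {b} (mkUnit za u zu hu) (mkUnit zb v zv hv) = mkUnit (⊗-integral za zb) (u ⊗ v) (⊗-integral zu zv)
    (≃-trans (≃-pointwise λ k → regroup (a k) (b k) (u k) (v k)) (≃-trans (⊗-cong hu hv) (≃-pointwise λ _ → refl)))
    where
    regroup : ∀ x y z w → (x * y) * (z * w) ≡ (x * z) * (y * w)
    regroup = solve-∀

  Unit-1 : Unit I1
  Unit-1 = mkUnit (cst-integral 1ℤ) I1 (cst-integral 1ℤ) (≃-pointwise λ _ → refl)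

  Unit-−1 : Unit M1
  Unit-−1 = mkUnit (cst-integral -1ℤ) M1 (cst-integral -1ℤ) (≃-pointwise λ _ → refl)

  IsSimilitude : Seq → Mat → Set
  IsSimilitude μ M = transpose M · Jm · M ≈ₘ scale μ Jm

  record GSp₄ (s : Mat) : Set where
    field
      s⁻¹ : Mat
      integral : IntegralMatrix s
      integral⁻¹ : IntegralMatrix s⁻¹
      inverseʳ : s · s⁻¹ ≈ₘ I₄
      inverseˡ : s⁻¹ · s ≈ₘ I₄
      μ : Seq
      μ-unit : Unit μ
      similitude : IsSimilitude μ s
      ν : Seq
      ν-unit : Unit ν
      similitude⁻¹ : IsSimilitude ν s⁻¹

  similitude-· : ∀ a b X Y → IsSimilitude a X → IsSimilitude b Y → IsSimilitude (b ⊗ a) (X · Y)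
  similitude-· a b X Y hX hY = begin
    transpose (X · Y) · Jm · (X · Y)             ≈⟨ ·-congˡ (X · Y) (·-congˡ Jm (≐⇒≈ₘ (transpose-· X Y))) ⟩
    transpose Y · transpose X · Jm · (X · Y)     ≈⟨ ≐⇒≈ₘ (·-assoc (transpose Y · transpose X) Jm (X · Y)) ⟩
    transpose Y · transpose X · (Jm · (X · Y))   ≈⟨ ≐⇒≈ₘ (·-assoc (transpose Y) (transpose X) (Jm · (X · Y))) ⟩
    transpose Y · (transpose X · (Jm · (X · Y))) ≈⟨ ·-congʳ (transpose Y) (≈ₘ-sym (≐⇒≈ₘ (·-assoc (transpose X) Jm (X · Y)))) ⟩
    transpose Y · (transpose X · Jm · (X · Y))   ≈⟨ ·-congʳ (transpose Y) (≈ₘ-sym (≐⇒≈ₘ (·-assoc (transpose X · Jm) X Y))) ⟩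
    transpose Y · (transpose X · Jm · X · Y)     ≈⟨ ·-congʳ (transpose Y) (·-congˡ Y hX) ⟩
    transpose Y · (scale a Jm · Y)               ≈⟨ ·-congʳ (transpose Y) (≐⇒≈ₘ (scale-·ˡ a Jm Y)) ⟩
    transpose Y · scale a (Jm · Y)               ≈⟨ ≐⇒≈ₘ (scale-·ʳ a (transpose Y) (Jm · Y)) ⟩
    scale a (transpose Y · (Jm · Y))             ≈⟨ scale-congʳ a (≈ₘ-sym (≐⇒≈ₘ (·-assoc (transpose Y) Jm Y))) ⟩
    scale a (transpose Y · Jm · Y)               ≈⟨ scale-congʳ a hY ⟩
    scale a (scale b Jm)                         ≈⟨ ≐⇒≈ₘ (scale-scale a b Jm) ⟩
    scale (b ⊗ a) Jm                             ∎
    where open SetoidReasoning ≈ₘ-setoid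

  inverse-· : ∀ X X⁻¹ Y Y⁻¹ → X · X⁻¹ ≈ₘ I₄ → Y · Y⁻¹ ≈ₘ I₄ → (X · Y) · (Y⁻¹ · X⁻¹) ≈ₘ I₄
  inverse-· X X⁻¹ Y Y⁻¹ hX hY = begin
    X · Y · (Y⁻¹ · X⁻¹)   ≈⟨ ≐⇒≈ₘ (·-assoc X Y (Y⁻¹ · X⁻¹)) ⟩
    X · (Y · (Y⁻¹ · X⁻¹)) ≈⟨ ·-congʳ X (≈ₘ-sym (≐⇒≈ₘ (·-assoc Y Y⁻¹ X⁻¹))) ⟩
    X · (Y · Y⁻¹ · X⁻¹)   ≈⟨ ·-congʳ X (·-congˡ X⁻¹ hY) ⟩
    X · (I₄ · X⁻¹)        ≈⟨ ·-congʳ X (≐⇒≈ₘ (·-identityˡ X⁻¹)) ⟩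
    X · X⁻¹               ≈⟨ hX ⟩
    I₄                    ∎
    where open SetoidReasoning ≈ₘ-setoid

  GSp₄-· : ∀ {s t} → GSp₄ s → GSp₄ t → GSp₄ (s · t)
  GSp₄-· {s} {t} S T = record
    { s⁻¹ = T.s⁻¹ · S.s⁻¹
    ; integral = ·-integral S.integral T.integral
    ; integral⁻¹ = ·-integral T.integral⁻¹ S.integral⁻¹
    ; inverseʳ = inverse-· s S.s⁻¹ t T.s⁻¹ S.inverseʳ T.inverseʳ
    ; inverseˡ = inverse-· T.s⁻¹ t S.s⁻¹ s T.inverseˡ S.inverseˡ
    ; μ = T.μ ⊗ S.μ
    ; μ-unit = Unit-⊗ T.μ-unit S.μ-unit
    ; similitude = similitude-· S.μ T.μ s t S.similitude T.similitude
    ; ν = S.ν ⊗ T.ν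
    ; ν-unit = Unit-⊗ S.ν-unit T.ν-unit
    ; similitude⁻¹ = similitude-· T.ν S.ν T.s⁻¹ S.s⁻¹ T.similitude⁻¹ S.similitude⁻¹
    }
    where
    module S = GSp₄ S
    module T = GSp₄ T

  record KElement (g : Mat) : Set where
    constructor mkKElement
    field
      integral : IntegralMatrix g
      μ : Seq
      μ-unit : Unit μ
      similitude : IsSimilitude μ g

  InK⇒KElement : ∀ {g} → InK p g → KElement g
  InK⇒KElement (zg , μ , zμ , (ν , zν , μν≈1) , sim) = mkKElement (mkIntegralMatrix λ i j → IsZp⇒Integral (zg i j)) μ
    (mkUnit (IsZp⇒Integral zμ) ν (IsZp⇒Integral zν) (≈⇒≃ μν≈1)) (mk≈ₘ λ i j → ≈⇒≃ (sim i j))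

  KElement⇒InK : ∀ {g} → KElement g → InK p g
  KElement⇒InK (mkKElement zg μ (mkUnit zμ ν zν μν≃1) sim) = (λ i j → Integral⇒IsZp (entry-integral zg i j))
    , μ , Integral⇒IsZp zμ , (ν , Integral⇒IsZp zν , ≃⇒≈ μν≃1) , λ i j → ≃⇒≈ (entry-≃ sim i j)

  GSp₄⇒InK : ∀ {s} → GSp₄ s → InK p s
  GSp₄⇒InK S = KElement⇒InK (mkKElement S.integral S.μ S.μ-unit S.similitude)
    where
    module S = GSp₄ S

-- Symbolic matrices

entrywise : {Q : Fin 4 → Fin 4 → Set} →
  Q f0 f0 → Q f0 f1 → Q f0 f2 → Q f0 f3 →
  Q f1 f0 → Q f1 f1 → Q f1 f2 → Q f1 f3 →
  Q f2 f0 → Q f2 f1 → Q f2 f2 → Q f2 f3 →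
  Q f3 f0 → Q f3 f1 → Q f3 f2 → Q f3 f3 → ∀ i j → Q i j
entrywise a _ _ _ _ _ _ _ _ _ _ _ _ _ _ _ zero zero = a
entrywise _ a _ _ _ _ _ _ _ _ _ _ _ _ _ _ zero (suc zero) = a
entrywise _ _ a _ _ _ _ _ _ _ _ _ _ _ _ _ zero (suc (suc zero)) = a
entrywise _ _ _ a _ _ _ _ _ _ _ _ _ _ _ _ zero (suc (suc (suc zero))) = a
entrywise _ _ _ _ a _ _ _ _ _ _ _ _ _ _ _ (suc zero) zero = a
entrywise _ _ _ _ _ a _ _ _ _ _ _ _ _ _ _ (suc zero) (suc zero) = a
entrywise _ _ _ _ _ _ a _ _ _ _ _ _ _ _ _ (suc zero) (suc (suc zero)) = a
entrywise _ _ _ _ _ _ _ a _ _ _ _ _ _ _ _ (suc zero) (suc (suc (suc zero))) = a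
entrywise _ _ _ _ _ _ _ _ a _ _ _ _ _ _ _ (suc (suc zero)) zero = a
entrywise _ _ _ _ _ _ _ _ _ a _ _ _ _ _ _ (suc (suc zero)) (suc zero) = a
entrywise _ _ _ _ _ _ _ _ _ _ a _ _ _ _ _ (suc (suc zero)) (suc (suc zero)) = a
entrywise _ _ _ _ _ _ _ _ _ _ _ a _ _ _ _ (suc (suc zero)) (suc (suc (suc zero))) = a
entrywise _ _ _ _ _ _ _ _ _ _ _ _ a _ _ _ (suc (suc (suc zero))) zero = a
entrywise _ _ _ _ _ _ _ _ _ _ _ _ _ a _ _ (suc (suc (suc zero))) (suc zero) = a
entrywise _ _ _ _ _ _ _ _ _ _ _ _ _ _ a _ (suc (suc (suc zero))) (suc (suc zero)) = a
entrywise _ _ _ _ _ _ _ _ _ _ _ _ _ _ _ a (suc (suc (suc zero))) (suc (suc (suc zero))) = a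

matrix : ∀ {C : Set} → C → C → C → C → C → C → C → C → C → C → C → C → C → C → C → C → Fin 4 → Fin 4 → C
matrix {C} = entrywise {λ _ _ → C}

SymbolicMat : ℕ → Set
SymbolicMat n = Fin 4 → Fin 4 → Polynomial n

⟦_⟧ₘ : ∀ {n} → SymbolicMat n → (ℕ → Vec ℤ n) → Mat
⟦ X ⟧ₘ ρ i j k = ⟦ X i j ⟧ (ρ k)

-- The same matrix written with mat, so that for a concrete symbolic matrix it is
-- definitionally the corresponding matrix U n q r, Jm, Z y or Dl inv l.
tabulateₘ : ∀ {n} → SymbolicMat n → (ℕ → Vec ℤ n) → Mat
tabulateₘ X ρ = mat (e f0 f0) (e f0 f1) (e f0 f2) (e f0 f3) (e f1 f0) (e f1 f1) (e f1 f2) (e f1 f3)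
                    (e f2 f0) (e f2 f1) (e f2 f2) (e f2 f3) (e f3 f0) (e f3 f1) (e f3 f2) (e f3 f3)
  where
  e : Fin 4 → Fin 4 → Seq
  e = ⟦ X ⟧ₘ ρ

tabulateₘ≐⟦⟧ₘ : ∀ {n} (X : SymbolicMat n) ρ → tabulateₘ X ρ ≐ ⟦ X ⟧ₘ ρ
tabulateₘ≐⟦⟧ₘ X ρ = entrywise (λ _ → refl) (λ _ → refl) (λ _ → refl) (λ _ → refl) (λ _ → refl) (λ _ → refl)
  (λ _ → refl) (λ _ → refl) (λ _ → refl) (λ _ → refl) (λ _ → refl) (λ _ → refl) (λ _ → refl) (λ _ → refl)
  (λ _ → refl) (λ _ → refl)

infixl 7 _·ₛ_
_·ₛ_ : ∀ {n} → SymbolicMat n → SymbolicMat n → SymbolicMat n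
(X ·ₛ Y) i j = X i f0 :* Y f0 j :+ X i f1 :* Y f1 j :+ X i f2 :* Y f2 j :+ X i f3 :* Y f3 j

transposeₛ : ∀ {n} → SymbolicMat n → SymbolicMat n
transposeₛ X i j = X j i

scaleₛ : ∀ {n} → Polynomial n → SymbolicMat n → SymbolicMat n
scaleₛ c X i j = c :* X i j

c0 c1 c-1 : ∀ {n} → Polynomial n
c0 = con 0ℤ
c1 = con 1ℤ
c-1 = con -1ℤ

Jₛ Iₛ : ∀ {n} → SymbolicMat n
Jₛ = matrix c0  c0  c1 c0
            c0  c0  c0 c1
            c-1 c0  c0 c0
            c0  c-1 c0 c0
Iₛ = matrix c1 c0 c0 c0
            c0 c1 c0 c0
            c0 c0 c1 c0
            c0 c0 c0 c1

SameSemantics : ∀ {n} → SymbolicMat n → SymbolicMat n → Set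
SameSemantics X Y = ∀ i j e → ⟦ X i j ⟧ e ≡ ⟦ Y i j ⟧ e

sameSemantics? : ∀ {n} (P Q : Polynomial n) → Maybe (∀ e → ⟦ P ⟧ e ≡ ⟦ Q ⟧ e)
sameSemantics? P Q = Maybe.map (λ P≈Q e → trans (sym (correct P e)) (trans (⟦ P≈Q ⟧N-cong e) (correct Q e)))
                               (normalise P ≟N normalise Q)

all? : ∀ {Q : Fin 4 → Set} → (∀ i → Maybe (Q i)) → Maybe (∀ i → Q i)
all? {Q} f with f f0 | f f1 | f f2 | f f3
... | just a | just b | just c | just d = just λ { zero → a ; (suc zero) → b ; (suc (suc zero)) → c ; (suc (suc (suc zero))) → d }
... | _ | _ | _ | _ = nothing

-- Decides SameSemantics by comparing ring normal forms; a proof of `Normalises X Y` is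
-- found by evaluation, so it never has to be written down.
Normalises : ∀ {n} → SymbolicMat n → SymbolicMat n → Set
Normalises X Y = T (is-just (all? λ i → all? λ j → sameSemantics? (X i j) (Y i j)))

normalises⇒same : ∀ {n} (X Y : SymbolicMat n) → Normalises X Y → SameSemantics X Y
normalises⇒same X Y h = to-witness-T _ h

module SymbolicGSp₄ (p : ℕ) where
  open PAdic p
  open PAdicMatrices p

  ≈ₘ-fromSemantics : ∀ {n} (X Y : SymbolicMat n) ρ → SameSemantics X Y → ⟦ X ⟧ₘ ρ ≈ₘ ⟦ Y ⟧ₘ ρ
  ≈ₘ-fromSemantics X Y ρ h = ≐⇒≈ₘ λ i j k → h i j (ρ k)

  ≈ₘ-modulo : ∀ {n} (X Y C₁ : SymbolicMat n) g₁ (C₂ : SymbolicMat n) g₂ ρ →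
    {_ : Normalises (λ i j → X i j :- Y i j) (λ i j → C₁ i j :* g₁ :+ C₂ i j :* g₂)} →
    (∀ k → pᵏ k ∣ˢ ⟦ g₁ ⟧ (ρ k)) → (∀ k → pᵏ k ∣ˢ ⟦ g₂ ⟧ (ρ k)) → ⟦ X ⟧ₘ ρ ≈ₘ ⟦ Y ⟧ₘ ρ
  ≈ₘ-modulo X Y C₁ g₁ C₂ g₂ ρ {h} d₁ d₂ = mk≈ₘ λ i j → mk≃ λ k →
    ∣-by (same i j (ρ k)) (⟦ C₁ i j ⟧ (ρ k) ⊠ d₁ k ⊞ ⟦ C₂ i j ⟧ (ρ k) ⊠ d₂ k)
    where
    same = normalises⇒same (λ i j → X i j :- Y i j) (λ i j → C₁ i j :* g₁ :+ C₂ i j :* g₂) h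

  IntegralValuation : ∀ {n} → (ℕ → Vec ℤ n) → Set
  IntegralValuation ρ = ∀ x → Integral (λ k → lookup (ρ k) x)

  polynomial-integral : ∀ {n} (P : Polynomial n) ρ → IntegralValuation ρ → Integral (λ k → ⟦ P ⟧ (ρ k))
  power-integral : ∀ {n} (P : Polynomial n) ρ → Integral (λ k → ⟦ P ⟧ (ρ k)) → ∀ m → Integral (λ k → ⟦ P :^ m ⟧ (ρ k))
  polynomial-integral (op +-*-Solver.[+] P Q) ρ h = ⊕-integral (polynomial-integral P ρ h) (polynomial-integral Q ρ h)
  polynomial-integral (op +-*-Solver.[*] P Q) ρ h = ⊗-integral (polynomial-integral P ρ h) (polynomial-integral Q ρ h)
  polynomial-integral (con c) ρ h = cst-integral c
  polynomial-integral (var x) ρ h = h x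
  polynomial-integral (P :^ m) ρ h = power-integral P ρ (polynomial-integral P ρ h) m
  polynomial-integral (:- P) ρ h = neg-integral (polynomial-integral P ρ h)
  power-integral P ρ h zero = cst-integral 1ℤ
  power-integral P ρ h (suc m) = ⊗-integral h (power-integral P ρ h m)

  constant-valuation : ∀ {n} (v : Vec ℤ n) → IntegralValuation (λ _ → v)
  constant-valuation v x = cst-integral (lookup v x)

  GSp₄-fromSymbolic : ∀ {n} (S S⁻¹ : SymbolicMat n) (μ ν : Polynomial n) ρ → IntegralValuation ρ →
    ⟦ S ·ₛ S⁻¹ ⟧ₘ ρ ≈ₘ ⟦ Iₛ ⟧ₘ ρ → ⟦ S⁻¹ ·ₛ S ⟧ₘ ρ ≈ₘ ⟦ Iₛ ⟧ₘ ρ →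
    ⟦ transposeₛ S ·ₛ Jₛ ·ₛ S ⟧ₘ ρ ≈ₘ ⟦ scaleₛ μ Jₛ ⟧ₘ ρ →
    ⟦ transposeₛ S⁻¹ ·ₛ Jₛ ·ₛ S⁻¹ ⟧ₘ ρ ≈ₘ ⟦ scaleₛ ν Jₛ ⟧ₘ ρ →
    Unit (λ k → ⟦ μ ⟧ (ρ k)) → Unit (λ k → ⟦ ν ⟧ (ρ k)) → GSp₄ (tabulateₘ S ρ)
  GSp₄-fromSymbolic S S⁻¹ μ ν ρ hρ hr hl hs hs⁻¹ uμ uν = record
    { s⁻¹ = ⟦ S⁻¹ ⟧ₘ ρ
    ; integral = mkIntegralMatrix λ i j →
        Integral-pointwise (λ k → sym (tabulateₘ≐⟦⟧ₘ S ρ i j k)) (polynomial-integral (S i j) ρ hρ)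
    ; integral⁻¹ = mkIntegralMatrix λ i j → polynomial-integral (S⁻¹ i j) ρ hρ
    ; inverseʳ = ≈ₘ-trans (·-congˡ (⟦ S⁻¹ ⟧ₘ ρ) s≈S) (≈ₘ-trans hr I≈)
    ; inverseˡ = ≈ₘ-trans (·-congʳ (⟦ S⁻¹ ⟧ₘ ρ) s≈S) (≈ₘ-trans hl I≈)
    ; μ = λ k → ⟦ μ ⟧ (ρ k)
    ; μ-unit = uμ
    ; similitude = ≈ₘ-trans (·-cong (·-cong (transpose-cong s≈S) J≈) s≈S)
                           (≈ₘ-trans hs (scale-congʳ (λ k → ⟦ μ ⟧ (ρ k)) (≈ₘ-sym J≈)))
    ; ν = λ k → ⟦ ν ⟧ (ρ k)
    ; ν-unit = uν
    ; similitude⁻¹ = ≈ₘ-trans (·-congˡ (⟦ S⁻¹ ⟧ₘ ρ) (·-congʳ (transpose (⟦ S⁻¹ ⟧ₘ ρ)) J≈))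
                             (≈ₘ-trans hs⁻¹ (scale-congʳ (λ k → ⟦ ν ⟧ (ρ k)) (≈ₘ-sym J≈)))
    }
    where
    s≈S = ≐⇒≈ₘ (tabulateₘ≐⟦⟧ₘ S ρ)
    J≈ = ≐⇒≈ₘ (tabulateₘ≐⟦⟧ₘ Jₛ ρ)
    I≈ = ≈ₘ-sym (≐⇒≈ₘ (tabulateₘ≐⟦⟧ₘ Iₛ ρ))

-- The factors U, J, Z_y and D_λ of the representatives

v₀ v₁ v₂ : ∀ {n} → Polynomial (suc (suc (suc n)))
v₀ = var zero
v₁ = var (suc zero)
v₂ = var (suc (suc zero))

Uₛ Uₛ⁻¹ : SymbolicMat 3
Uₛ   = matrix c1 c0 v₀ v₁
              c0 c1 v₁ v₂
              c0 c0 c1 c0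
              c0 c0 c0 c1
Uₛ⁻¹ = matrix c1 c0 (:- v₀) (:- v₁)
              c0 c1 (:- v₁) (:- v₂)
              c0 c0 c1      c0
              c0 c0 c0      c1

Jₛ⁻¹ : SymbolicMat 0
Jₛ⁻¹ = matrix c0 c0 c-1 c0
              c0 c0 c0  c-1
              c1 c0 c0  c0
              c0 c1 c0  c0

Zₛ Zₛ⁻¹ : SymbolicMat 1
Zₛ   = matrix c1 (var zero) c0            c0
              c0 c1         c0            c0
              c0 c0         c1            c0
              c0 c0         (:- var zero) c1
Zₛ⁻¹ = matrix c1 (:- var zero) c0         c0
              c0 c1            c0         c0
              c0 c0            c1         c0
              c0 c0            (var zero) c1

Z∞ₛ : SymbolicMat 0
Z∞ₛ = matrix c0 c1 c0 c0
             c1 c0 c0 c0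
             c0 c0 c0 c1
             c0 c0 c1 c0

D₀ₛ D₀ₛ⁻¹ : SymbolicMat 0
D₀ₛ   = matrix c0  c0  c0 c1
               c-1 c0  c0 c0
               c0  c1  c0 c0
               c0  c0  c1 c0
D₀ₛ⁻¹ = matrix c0 c-1 c0 c0
               c0 c0  c1 c0
               c0 c0  c0 c1
               c1 c0  c0 c0

D∞ₛ : SymbolicMat 0
D∞ₛ = matrix c-1 c0 c0 c0
             c0  c0 c0 c1
             c0  c0 c1 c0
             c0  c1 c0 c0

-- Variables: v₀ = λ, v₁ = λ⁻¹, v₂ = 1/2.
Dₛ Dₛ⁻¹ : SymbolicMat 3
Dₛ   = matrix (:- v₀) c0 c0 c1
              c1      c0 c0 v₁
              c0      c1 v₁ c0
              c0      v₀ c-1 c0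
Dₛ⁻¹ = matrix (:- (v₁ :* v₂)) v₂        c0        c0
              c0              c0        v₂        (v₁ :* v₂)
              c0              c0        (v₀ :* v₂) (:- v₂)
              v₂              (v₀ :* v₂) c0        c0

module Generators (p : ℕ) where
  open PAdic p
  open PAdicMatrices p
  open SymbolicGSp₄ p

  GSp₄-byNormalisation : ∀ {n} (S S⁻¹ : SymbolicMat n) (μ : ℤ) ρ → IntegralValuation ρ → Unit (cst μ) →
    {_ : Normalises (S ·ₛ S⁻¹) Iₛ} {_ : Normalises (S⁻¹ ·ₛ S) Iₛ}
    {_ : Normalises (transposeₛ S ·ₛ Jₛ ·ₛ S) (scaleₛ (con μ) Jₛ)}
    {_ : Normalises (transposeₛ S⁻¹ ·ₛ Jₛ ·ₛ S⁻¹) (scaleₛ (con μ) Jₛ)} → GSp₄ (tabulateₘ S ρ)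
  GSp₄-byNormalisation S S⁻¹ μ ρ hρ u {r} {l} {sim} {sim⁻¹} =
    GSp₄-fromSymbolic S S⁻¹ (con μ) (con μ) ρ hρ
      (exact (S ·ₛ S⁻¹) Iₛ r) (exact (S⁻¹ ·ₛ S) Iₛ l)
      (exact (transposeₛ S ·ₛ Jₛ ·ₛ S) (scaleₛ (con μ) Jₛ) sim)
      (exact (transposeₛ S⁻¹ ·ₛ Jₛ ·ₛ S⁻¹) (scaleₛ (con μ) Jₛ) sim⁻¹) u u
    where
    exact : ∀ X Y → Normalises X Y → ⟦ X ⟧ₘ ρ ≈ₘ ⟦ Y ⟧ₘ ρ
    exact X Y h = ≈ₘ-fromSemantics X Y ρ (normalises⇒same X Y h)

  GSp₄-U : ∀ (n q r : Fin p) → GSp₄ (U n q r)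
  GSp₄-U n q r = GSp₄-byNormalisation Uₛ Uₛ⁻¹ 1ℤ (λ _ → nqr) (constant-valuation nqr) Unit-1
    where
    nqr : Vec ℤ 3
    nqr = + toℕ n ∷ + toℕ q ∷ + toℕ r ∷ []

  GSp₄-J : GSp₄ Jm
  GSp₄-J = GSp₄-byNormalisation Jₛ Jₛ⁻¹ 1ℤ (λ _ → []) (constant-valuation []) Unit-1

  GSp₄-Z : ∀ (y : V p) → GSp₄ (Z y)
  GSp₄-Z (just y) = GSp₄-byNormalisation Zₛ Zₛ⁻¹ 1ℤ (λ _ → + toℕ y ∷ []) (constant-valuation (+ toℕ y ∷ [])) Unit-1
  GSp₄-Z nothing = GSp₄-byNormalisation Z∞ₛ Z∞ₛ 1ℤ (λ _ → []) (constant-valuation []) Unit-1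

  GSp₄-D₀ : ∀ {n} (inv : ℕ → Seq) → GSp₄ (Dl {suc n} inv (just zero))
  GSp₄-D₀ inv = GSp₄-byNormalisation D₀ₛ D₀ₛ⁻¹ -1ℤ (λ _ → []) (constant-valuation []) Unit-−1

  GSp₄-D∞ : ∀ {n} (inv : ℕ → Seq) → GSp₄ (Dl {n} inv nothing)
  GSp₄-D∞ inv = GSp₄-byNormalisation D∞ₛ D∞ₛ -1ℤ (λ _ → []) (constant-valuation []) Unit-−1

  -- D_λ has multiplier −2, so its inverse involves 1/2: this is where p odd is needed.
  GSp₄-D : ∀ {n} (inv : ℕ → Seq) (l : Fin n) → let λ′ = suc (toℕ l) in
    Integral (inv λ′) → Integral (inv 2) →
    (∀ k → pᵏ k ∣ˢ (+ λ′ * inv λ′ k - 1ℤ)) → (∀ k → pᵏ k ∣ˢ (+ 2 * inv 2 k - 1ℤ)) →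
    GSp₄ (Dl {suc n} inv (just (suc l)))
  GSp₄-D inv l λ⁻¹-integral ½-integral λλ⁻¹≡1 2½≡1 =
    GSp₄-fromSymbolic Dₛ Dₛ⁻¹ (con (- + 2)) (:- v₂) ρ hρ
      (≈ₘ-modulo (Dₛ ·ₛ Dₛ⁻¹) Iₛ (scaleₛ v₂ Iₛ) g₁ Iₛ g₂ ρ λλ⁻¹≡1 2½≡1)
      (≈ₘ-modulo (Dₛ⁻¹ ·ₛ Dₛ) Iₛ (scaleₛ v₂ Iₛ) g₁ Iₛ g₂ ρ λλ⁻¹≡1 2½≡1)
      (≈ₘ-modulo (transposeₛ Dₛ ·ₛ Jₛ ·ₛ Dₛ) (scaleₛ (con (- + 2)) Jₛ) (scaleₛ c-1 Jₛ) g₁ (scaleₛ c0 Jₛ) g₂ ρ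
                 λλ⁻¹≡1 2½≡1)
      (≈ₘ-modulo (transposeₛ Dₛ⁻¹ ·ₛ Jₛ ·ₛ Dₛ⁻¹) (scaleₛ (:- v₂) Jₛ) (scaleₛ (:- (v₂ :* v₂)) Jₛ) g₁ (scaleₛ (:- v₂) Jₛ) g₂ ρ
                 λλ⁻¹≡1 2½≡1)
      (mkUnit (cst-integral _) (neg (inv 2)) (neg-integral ½-integral)
              (mk≃ λ k → ∣-by (rearrange (inv 2 k)) (2½≡1 k)))
      (mkUnit (neg-integral ½-integral) (cst (- + 2)) (cst-integral _)
              (mk≃ λ k → ∣-by (trans (cong (_- 1ℤ) (ℤP.*-comm (- inv 2 k) (- + 2))) (rearrange (inv 2 k))) (2½≡1 k)))
    where
    ρ : ℕ → Vec ℤ 3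
    ρ k = + suc (toℕ l) ∷ inv (suc (toℕ l)) k ∷ inv 2 k ∷ []
    hρ : IntegralValuation ρ
    hρ zero = cst-integral _
    hρ (suc zero) = λ⁻¹-integral
    hρ (suc (suc zero)) = ½-integral
    g₁ g₂ : Polynomial 3
    g₁ = v₀ :* v₁ :- c1
    g₂ = con (+ 2) :* v₂ :- c1
    rearrange : ∀ h → (- + 2) * (- h) - 1ℤ ≡ + 2 * h - 1ℤ
    rearrange = solve-∀

odd-prime⇒2<p : ∀ {p} → Prime p → ¬ (2 ∣ p) → 2 < p
odd-prime⇒2<p {p} p-prime odd with ℕP.m≤n⇒m<n∨m≡n (ℕ.nonTrivial⇒n>1 p {{prime⇒nonTrivial p-prime}})
... | inj₁ 2<p = 2<p
... | inj₂ refl = ⊥-elim (odd ℕD.∣-refl)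

module Representatives (p : ℕ) (p-prime : Prime p) (p-odd : ¬ (2 ∣ p)) (inv : ℕ → Seq)
  (inv-spec : ∀ l → 1 ≤ l → l < p → IsZp p (inv l) × ((nat l ⊗ inv l) ≈[ p ] I1)) where
  open PAdic p
  open PAdicMatrices p
  open Generators p

  GSp₄-Dl : ∀ (l : V p) → GSp₄ (Dl inv l)
  GSp₄-Dl nothing = GSp₄-D∞ {p} inv
  GSp₄-Dl (just l) = go l ℕP.≤-refl
    where
    go : ∀ {m} (l : Fin m) → m ℕ.≤ p → GSp₄ (Dl {m} inv (just l))
    go {suc m} zero _ = GSp₄-D₀ {m} inv
    go (suc l) m≤p = GSp₄-D inv l (inv-integral λ′<p) (inv-integral 2<p) (inv-inverse λ′<p) (inv-inverse 2<p)
      where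
      λ′<p = ℕP.<-≤-trans (FP.toℕ<n (suc l)) m≤p
      2<p = odd-prime⇒2<p p-prime p-odd
      inv-integral : ∀ {l} → suc l < p → Integral (inv (suc l))
      inv-integral l<p = IsZp⇒Integral (proj₁ (inv-spec _ (s≤s z≤n) l<p))
      inv-inverse : ∀ {l} → suc l < p → ∀ k → pᵏ k ∣ˢ (+ suc l * inv (suc l) k - 1ℤ)
      inv-inverse l<p k = ∣ᵤ⇒∣ (proj₂ (inv-spec _ (s≤s z≤n) l<p) k)

  GSp₄-rep : ∀ (i : Idx p) → GSp₄ (rep inv i)
  GSp₄-rep (A n q r y) = GSp₄-· (GSp₄-· (GSp₄-U n q r) GSp₄-J) (GSp₄-Z y)
  GSp₄-rep (B n q r y) = GSp₄-· (GSp₄-· (GSp₄-· GSp₄-J (GSp₄-U n q r)) GSp₄-J) (GSp₄-Z y)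
  GSp₄-rep (D l y) = GSp₄-· (GSp₄-Dl l) (GSp₄-Z y)

-- Arithmetic modulo p

module ResidueField (p : ℕ) (p-prime : Prime p) where
  instance
    p≢0 : NonZero p
    p≢0 = prime⇒nonZero p-prime

  infix 4 p∣_ p∤_
  p∣_ p∤_ : ℤ → Set
  p∣ x = + p ∣ˢ x
  p∤ x = ¬ p∣ x

  p∣p : p∣ (+ p)
  p∣p = divides 1ℤ (sym (ℤP.*-identityˡ (+ p)))

  p∤1 : p∤ 1ℤ
  p∤1 h = ℕP.<⇒≱ (ℕ.nonTrivial⇒n>1 p {{prime⇒nonTrivial p-prime}}) (ℕD.∣⇒≤ (∣⇒∣ᵤ h))

  p∣? : ∀ a → p∣ a ⊎ p∤ a
  p∣? a with p ℕD.∣? ℤ.∣ a ∣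
  ... | yes h = inj₁ (∣ᵤ⇒∣ h)
  ... | no h = inj₂ λ d → h (∣⇒∣ᵤ d)

  p∣-* : ∀ a b → p∣ (a * b) → p∣ a ⊎ p∣ b
  p∣-* a b h with euclidsLemma ℤ.∣ a ∣ ℤ.∣ b ∣ p-prime (subst (p ℕD.∣_) (ℤP.abs-* a b) (∣⇒∣ᵤ h))
  ... | inj₁ d = inj₁ (∣ᵤ⇒∣ d)
  ... | inj₂ d = inj₂ (∣ᵤ⇒∣ d)

  p∤-* : ∀ {a b} → p∤ a → p∤ b → p∤ (a * b)
  p∤-* {a} {b} p∤a p∤b h with p∣-* a b h
  ... | inj₁ d = p∤a d
  ... | inj₂ d = p∤b d

  p∣-cancelˡ : ∀ a b → p∤ a → p∣ (a * b) → p∣ b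
  p∣-cancelˡ a b p∤a h with p∣-* a b h
  ... | inj₁ d = ⊥-elim (p∤a d)
  ... | inj₂ d = d

  residue : ℤ → Fin p
  residue a = fromℕ< (n%ℕd<d a p)

  residue-≡ : ∀ a → p∣ (+ toℕ (residue a) - a)
  residue-≡ a = subst (λ r → p∣ (+ r - a)) (sym (FP.toℕ-fromℕ< (n%ℕd<d a p)))
    (∣-by (trans (cong (λ x → + (a %ℕ p) - x) (a≡a%ℕn+[a/ℕn]*n a p)) (cancel (+ (a %ℕ p)) (a /ℕ p) (+ p)))
          ((- (a /ℕ p)) ⊠ p∣p))
    where
    cancel : ∀ r q m → r - (r + q * m) ≡ (- q) * m
    cancel = solve-∀

  p∣-<p⇒≡0 : ∀ {n} → n ℕ.< p → p ℕD.∣ n → n ≡ 0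
  p∣-<p⇒≡0 {zero} _ _ = refl
  p∣-<p⇒≡0 {suc n} n<p d = ⊥-elim (ℕP.<⇒≱ n<p (ℕD.∣⇒≤ d))

  ≡-mod-p⇒≤ : ∀ {x y} → y ℕ.< p → p∣ (+ x - + y) → y ℕ.≤ x
  ≡-mod-p⇒≤ {x} {y} y<p h with ℕP.≤-total x y
  ... | inj₂ y≤x = y≤x
  ... | inj₁ x≤y = ℕP.m∸n≡0⇒m≤n (p∣-<p⇒≡0 (ℕP.≤-<-trans (ℕP.m∸n≤m y x) y<p)
                     (subst (p ℕD.∣_) (trans (cong ℤ.∣_∣ (ℤP.[+m]-[+n]≡m⊖n x y)) (ℤP.∣⊖∣-≤ x≤y)) (∣⇒∣ᵤ h)))

  residues-distinct : ∀ (a b : Fin p) → p∣ (+ toℕ a - + toℕ b) → a ≡ b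
  residues-distinct a b h = FP.toℕ-injective
    (ℕP.≤-antisym (≡-mod-p⇒≤ (FP.toℕ<n a) (∣-by (swap (+ toℕ b) (+ toℕ a)) (-1ℤ ⊠ h))) (≡-mod-p⇒≤ (FP.toℕ<n b) h))
    where
    swap : ∀ x y → x - y ≡ -1ℤ * (y - x)
    swap = solve-∀

  inverse : ∀ a → p∤ a → Σ ℤ λ b → p∣ (a * b - 1ℤ)
  inverse a p∤a = fromBézout (coprime-Bézout (prime⇒coprime p-prime {{r≢0}} (FP.toℕ<n (residue a))))
    where
    r = toℕ (residue a)
    r≢0 : NonZero r
    r≢0 with r in r≡
    ... | zero = ⊥-elim (p∤a (∣-by (negate a) (-1ℤ ⊠ subst (λ t → p∣ (+ t - a)) r≡ (residue-≡ a))))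
      where
      negate : ∀ a → a ≡ -1ℤ * (0ℤ - a)
      negate = solve-∀
    ... | suc _ = _
    vanish : ∀ x y m n → 1 ℕ.+ y ℕ.* m ≡ x ℕ.* n → 1ℤ + + y * + m - + x * + n ≡ 0ℤ
    vanish x y m n eq = trans (cong₂ (λ u v → 1ℤ + u - v) (sym (ℤP.pos-* y m)) (sym (ℤP.pos-* x n)))
      (trans (cong (λ t → t - + (x ℕ.* n)) (trans (sym (ℤP.pos-+ 1 (y ℕ.* m))) (cong +_ eq))) (ℤP.+-inverseʳ (+ (x ℕ.* n))))
    fromBézout : GCD.Bézout.Identity 1 p r → Σ ℤ λ b → p∣ (a * b - 1ℤ)
    fromBézout (GCD.Bézout.+- x y 1+yr≡xp) = - + y ,
      ∣-by (rearrange a (+ y) (+ r) (+ x) (+ p)) ((- + x) ⊠ p∣p ⊞ (+ y) ⊠ residue-≡ a ⊞ -1ℤ ⊠ ∣-by (vanish x y r p 1+yr≡xp) ∣0)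
      where
      rearrange : ∀ a y r x m → a * (- y) - 1ℤ ≡ (- x) * m + y * (r - a) + -1ℤ * (1ℤ + y * r - x * m)
      rearrange = solve-∀
    fromBézout (GCD.Bézout.-+ x y 1+xp≡yr) = + y ,
      ∣-by (rearrange a (+ y) (+ r) (+ x) (+ p)) ((+ x) ⊠ p∣p ⊞ (- + y) ⊠ residue-≡ a ⊞ -1ℤ ⊠ ∣-by (vanish y x p r 1+xp≡yr) ∣0)
      where
      rearrange : ∀ a y r x m → a * y - 1ℤ ≡ x * m + (- y) * (r - a) + -1ℤ * (1ℤ + x * m - y * r)
      rearrange = solve-∀

  infix 4 _≡ₚ_
  record _≡ₚ_ (a b : ℤ) : Set where
    constructor mkₚ
    field p∣difference : p∣ (a - b)
  open _≡ₚ_ public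

  ≡⇒≡ₚ : ∀ {a b} → a ≡ b → a ≡ₚ b
  ≡⇒≡ₚ {a} refl = mkₚ (∣-by (ℤP.+-inverseʳ a) ∣0)

  ≡ₚ-refl : ∀ {a} → a ≡ₚ a
  ≡ₚ-refl = ≡⇒≡ₚ refl

  ≡ₚ-sym : ∀ {a b} → a ≡ₚ b → b ≡ₚ a
  ≡ₚ-sym {a} {b} (mkₚ h) = mkₚ (∣-by (swap a b) (-1ℤ ⊠ h))
    where
    swap : ∀ a b → b - a ≡ -1ℤ * (a - b)
    swap = solve-∀

  ≡ₚ-trans : ∀ {a b c} → a ≡ₚ b → b ≡ₚ c → a ≡ₚ c
  ≡ₚ-trans {a} {b} {c} (mkₚ h₁) (mkₚ h₂) = mkₚ (∣-by (split a b c) (h₁ ⊞ h₂))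
    where
    split : ∀ a b c → a - c ≡ (a - b) + (b - c)
    split = solve-∀

  +-congₚ : ∀ {a a′ b b′} → a ≡ₚ a′ → b ≡ₚ b′ → a + b ≡ₚ a′ + b′
  +-congₚ {a} {a′} {b} {b′} (mkₚ h₁) (mkₚ h₂) = mkₚ (∣-by (split a a′ b b′) (h₁ ⊞ h₂))
    where
    split : ∀ a a′ b b′ → (a + b) - (a′ + b′) ≡ (a - a′) + (b - b′)
    split = solve-∀

  -‿congₚ : ∀ {a a′} → a ≡ₚ a′ → - a ≡ₚ - a′
  -‿congₚ {a} {a′} (mkₚ h) = mkₚ (∣-by (split a a′) (-1ℤ ⊠ h))
    where
    split : ∀ a a′ → (- a) - (- a′) ≡ -1ℤ * (a - a′)
    split = solve-∀

  *-congₚ : ∀ {a a′ b b′} → a ≡ₚ a′ → b ≡ₚ b′ → a * b ≡ₚ a′ * b′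
  *-congₚ {a} {a′} {b} {b′} (mkₚ h₁) (mkₚ h₂) = mkₚ (∣-by (split a a′ b b′) (b ⊠ h₁ ⊞ a′ ⊠ h₂))
    where
    split : ∀ a a′ b b′ → a * b - a′ * b′ ≡ b * (a - a′) + a′ * (b - b′)
    split = solve-∀

  *-congˡₚ : ∀ c {b b′} → b ≡ₚ b′ → c * b ≡ₚ c * b′
  *-congˡₚ c = *-congₚ (≡ₚ-refl {c})

  minus-congₚ : ∀ {a a′ b b′} → a ≡ₚ a′ → b ≡ₚ b′ → a - b ≡ₚ a′ - b′
  minus-congₚ h₁ h₂ = +-congₚ h₁ (-‿congₚ h₂)

  record Kernel (x y x′ y′ : ℤ) : Set where
    field
      α β : ℤ
      nonzero : ¬ (p∣ α × p∣ β)
      first : p∣ (α * x + β * y)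
      second : p∣ (α * x′ + β * y′)

  p∣-neg : ∀ {x} → p∣ (- x) → p∣ x
  p∣-neg {x} d = ∣-by (cert x) (-1ℤ ⊠ d)
    where
    cert : ∀ x → x ≡ -1ℤ * (- x)
    cert = solve-∀

  Kernel-fromFirst : ∀ {x y x′ y′} → p∣ (x * y′ - x′ * y) → p∤ y ⊎ p∤ x → Kernel x y x′ y′
  Kernel-fromFirst {x} {y} {x′} {y′} det nz = record
    { α = y ; β = - x
    ; nonzero = λ { (p∣y , p∣-x) → [ (λ p∤y → p∤y p∣y) , (λ p∤x → p∤x (p∣-neg p∣-x)) ] nz }
    ; first = ∣-by (cert₁ x y) ∣0
    ; second = ∣-by (cert₂ x y x′ y′) (-1ℤ ⊠ det)
    }
    where
    cert₁ : ∀ x y → y * x + (- x) * y ≡ 0ℤ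
    cert₁ = solve-∀
    cert₂ : ∀ x y x′ y′ → y * x′ + (- x) * y′ ≡ -1ℤ * (x * y′ - x′ * y)
    cert₂ = solve-∀

  Kernel-fromSecond : ∀ {x y x′ y′} → p∣ (x * y′ - x′ * y) → p∤ y′ ⊎ p∤ x′ → Kernel x y x′ y′
  Kernel-fromSecond {x} {y} {x′} {y′} det nz = record
    { α = y′ ; β = - x′
    ; nonzero = λ { (p∣y′ , p∣-x′) → [ (λ p∤y′ → p∤y′ p∣y′) , (λ p∤x′ → p∤x′ (p∣-neg p∣-x′)) ] nz }
    ; first = ∣-by (cert₁ x y x′ y′) det
    ; second = ∣-by (cert₂ x′ y′) ∣0
    }
    where
    cert₁ : ∀ x y x′ y′ → y′ * x + (- x′) * y ≡ x * y′ - x′ * y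
    cert₁ = solve-∀
    cert₂ : ∀ x′ y′ → y′ * x′ + (- x′) * y′ ≡ 0ℤ
    cert₂ = solve-∀

  singular⇒Kernel : ∀ x y x′ y′ → p∣ (x * y′ - x′ * y) → Kernel x y x′ y′
  singular⇒Kernel x y x′ y′ det with p∣? y | p∣? x | p∣? y′ | p∣? x′
  ... | inj₂ p∤y | _ | _ | _ = Kernel-fromFirst det (inj₁ p∤y)
  ... | inj₁ _ | inj₂ p∤x | _ | _ = Kernel-fromFirst det (inj₂ p∤x)
  ... | inj₁ _ | inj₁ _ | inj₂ p∤y′ | _ = Kernel-fromSecond det (inj₁ p∤y′)
  ... | inj₁ _ | inj₁ _ | inj₁ _ | inj₂ p∤x′ = Kernel-fromSecond det (inj₂ p∤x′)
  ... | inj₁ p∣y | inj₁ p∣x | inj₁ p∣y′ | inj₁ p∣x′ = record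
    { α = 1ℤ ; β = 0ℤ ; nonzero = λ { (p∣1 , _) → p∤1 p∣1 }
    ; first = ∣-by (cert x y) p∣x ; second = ∣-by (cert x′ y′) p∣x′ }
    where
    cert : ∀ x y → 1ℤ * x + 0ℤ * y ≡ x
    cert = solve-∀

-- Iwahori cosets and flags

Column : Set
Column = Fin 4 → ℤ

-- Column j of X reduced modulo p, i.e. at level 1 of the inverse system.
column : Mat → Fin 4 → Column
column X j i = X i j 1

Flag : Set
Flag = Column × Column

flagOf : Mat → Flag
flagOf X = column X f0 , column X f1

infix 4 _≗ᶠ_
_≗ᶠ_ : Flag → Flag → Set
F ≗ᶠ G = ∀ r → proj₁ F r ≡ proj₁ G r × proj₂ F r ≡ proj₂ G r

≗ᶠ-byRows : ∀ {F G : Flag} →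
  proj₁ F f0 ≡ proj₁ G f0 × proj₂ F f0 ≡ proj₂ G f0 → proj₁ F f1 ≡ proj₁ G f1 × proj₂ F f1 ≡ proj₂ G f1 →
  proj₁ F f2 ≡ proj₁ G f2 × proj₂ F f2 ≡ proj₂ G f2 → proj₁ F f3 ≡ proj₁ G f3 × proj₂ F f3 ≡ proj₂ G f3 → F ≗ᶠ G
≗ᶠ-byRows e₀ e₁ e₂ e₃ zero = e₀
≗ᶠ-byRows e₀ e₁ e₂ e₃ (suc zero) = e₁
≗ᶠ-byRows e₀ e₁ e₂ e₃ (suc (suc zero)) = e₂
≗ᶠ-byRows e₀ e₁ e₂ e₃ (suc (suc (suc zero))) = e₃

≗ᶠ-trans : ∀ {F G H} → F ≗ᶠ G → G ≗ᶠ H → F ≗ᶠ H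
≗ᶠ-trans e₁ e₂ r = trans (proj₁ (e₁ r)) (proj₁ (e₂ r)) , trans (proj₂ (e₁ r)) (proj₂ (e₂ r))

ω : Column → Column → ℤ
ω u v = u f0 * v f2 + u f1 * v f3 - u f2 * v f0 - u f3 * v f1

transpose·J·-entry : ∀ (X : Mat) i j → (transpose X · Jm · X) i j 1 ≡ ω (column X i) (column X j)
transpose·J·-entry X i j = expand (X f0 i 1) (X f1 i 1) (X f2 i 1) (X f3 i 1) (X f0 j 1) (X f1 j 1) (X f2 j 1) (X f3 j 1)
  where
  expand : ∀ a0 a1 a2 a3 b0 b1 b2 b3 →
    (a0 * 0ℤ + a1 * 0ℤ + a2 * -1ℤ + a3 * 0ℤ) * b0 + (a0 * 0ℤ + a1 * 0ℤ + a2 * 0ℤ + a3 * -1ℤ) * b1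
      + (a0 * 1ℤ + a1 * 0ℤ + a2 * 0ℤ + a3 * 0ℤ) * b2 + (a0 * 0ℤ + a1 * 1ℤ + a2 * 0ℤ + a3 * 0ℤ) * b3
    ≡ a0 * b2 + a1 * b3 - a2 * b0 - a3 * b1
  expand = solve-∀

module Cosets (p : ℕ) (p-prime : Prime p) where
  open PAdic p
  open PAdicMatrices p
  open ResidueField p p-prime

  level₁ : ∀ {x y} → x ≃ y → x 1 ≡ₚ y 1
  level₁ {x} {y} (mk≃ h) = mkₚ (subst (_∣ˢ (x 1 - y 1)) (cong +_ (ℕP.*-identityʳ p)) (h 1))

  p∤-factor : ∀ x y μ → p∣ (x * y - μ) → p∤ μ → p∤ x
  p∤-factor x y μ xy≡μ p∤μ p∣x = p∤μ (∣-by (rearrange x y μ) (y ⊠ p∣x ⊞ -1ℤ ⊠ xy≡μ))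
    where
    rearrange : ∀ x y μ → μ ≡ y * x + -1ℤ * (x * y - μ)
    rearrange = solve-∀

  Unit⇒p∤ : ∀ {μ} → Unit μ → p∤ (μ 1)
  Unit⇒p∤ u = p∤-factor _ (Unit.inverse u 1) 1ℤ (p∣difference (level₁ (Unit.inverse-eq u))) p∤1

  ω-relation : ∀ μ X → IsSimilitude μ X → ∀ i j → ω (column X i) (column X j) ≡ₚ μ 1 * Jm i j 1
  ω-relation μ X sim i j = ≡ₚ-trans (≡⇒≡ₚ (sym (transpose·J·-entry X i j))) (level₁ (entry-≃ sim i j))

  -- F = (C₀, C₁) and G define the same flag ⟨C₁⟩ ⊂ ⟨C₀, C₁⟩ in 𝔽ₚ⁴.
  record SameFlag (F G : Flag) : Set where
    field
      a b c : ℤ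
      p∤a : p∤ a
      p∤c : p∤ c
      column₀ : ∀ r → proj₁ F r ≡ₚ a * proj₁ G r + b * proj₂ G r
      column₁ : ∀ r → proj₂ F r ≡ₚ c * proj₂ G r

    p∣column₀ : ∀ r → p∣ (proj₁ F r - (a * proj₁ G r + b * proj₂ G r))
    p∣column₀ r = p∣difference (column₀ r)

    p∣column₁ : ∀ r → p∣ (proj₂ F r - c * proj₂ G r)
    p∣column₁ r = p∣difference (column₁ r)

  SameFlag-resp : ∀ {F F′ G G′} → F ≗ᶠ F′ → G ≗ᶠ G′ → SameFlag F G → SameFlag F′ G′
  SameFlag-resp eF eG R = record
    { a = a ; b = b ; c = c ; p∤a = p∤a ; p∤c = p∤c
    ; column₀ = λ r → ≡ₚ-trans (≡ₚ-sym (≡⇒≡ₚ (proj₁ (eF r))))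
        (≡ₚ-trans (column₀ r) (≡⇒≡ₚ (cong₂ (λ u v → a * u + b * v) (proj₁ (eG r)) (proj₂ (eG r)))))
    ; column₁ = λ r → ≡ₚ-trans (≡ₚ-sym (≡⇒≡ₚ (proj₂ (eF r)))) (≡ₚ-trans (column₁ r) (≡⇒≡ₚ (cong (c *_) (proj₂ (eG r)))))
    }
    where open SameFlag R

  ZeroModP⇒p∣ : ∀ x → ZeroModP p x → p∣ (x 1)
  ZeroModP⇒p∣ x = ∣ᵤ⇒∣ {+ p} {x 1}

  ≡ₚ-zero : ∀ {x y} → x ≡ₚ y → y ≡ 0ℤ → p∣ x
  ≡ₚ-zero (mkₚ h) refl = ∣-by (sym (ℤP.+-identityʳ _)) h

  ω-diagonal₀₂ : ∀ μ h → IsSimilitude μ h → p∣ (h f2 f0 1) → p∣ (h f3 f0 1) → p∣ (h f3 f2 1) →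
    p∣ (h f0 f0 1 * h f2 f2 1 - μ 1)
  ω-diagonal₀₂ μ h sim h₂₀ h₃₀ h₃₂ = ∣-by (expand (e f0 f0) (e f1 f0) (e f2 f0) (e f3 f0) (e f0 f2) (e f1 f2) (e f2 f2) (e f3 f2) (μ 1))
    (p∣difference (ω-relation μ h sim f0 f2) ⊞ (- e f1 f0) ⊠ h₃₂ ⊞ e f0 f2 ⊠ h₂₀ ⊞ e f1 f2 ⊠ h₃₀)
    where
    e : Fin 4 → Fin 4 → ℤ
    e i j = h i j 1
    expand : ∀ h00 h10 h20 h30 h02 h12 h22 h32 μ → h00 * h22 - μ ≡
      ((h00 * h22 + h10 * h32 - h20 * h02 - h30 * h12) - μ * 1ℤ) + (- h10) * h32 + h02 * h20 + h12 * h30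
    expand = solve-∀

  ω-diagonal₁₃ : ∀ μ h → IsSimilitude μ h → p∣ (h f0 f1 1) → p∣ (h f2 f1 1) → p∣ (h f3 f1 1) →
    p∣ (h f1 f1 1 * h f3 f3 1 - μ 1)
  ω-diagonal₁₃ μ h sim h₀₁ h₂₁ h₃₁ = ∣-by (expand (e f0 f1) (e f1 f1) (e f2 f1) (e f3 f1) (e f0 f3) (e f1 f3) (e f2 f3) (e f3 f3) (μ 1))
    (p∣difference (ω-relation μ h sim f1 f3) ⊞ (- e f2 f3) ⊠ h₀₁ ⊞ e f0 f3 ⊠ h₂₁ ⊞ e f1 f3 ⊠ h₃₁)
    where
    e : Fin 4 → Fin 4 → ℤ
    e i j = h i j 1
    expand : ∀ h01 h11 h21 h31 h03 h13 h23 h33 μ → h11 * h33 - μ ≡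
      ((h01 * h23 + h11 * h33 - h21 * h03 - h31 * h13) - μ * 1ℤ) + (- h23) * h01 + h03 * h21 + h13 * h31
    expand = solve-∀

  InCoset⇒SameFlag : ∀ {S S′} → InCoset p S S′ → SameFlag (flagOf S) (flagOf S′)
  InCoset⇒SameFlag {S} {S′} (h , (h∈K , z₀₁ , z₂₀ , z₂₁ , z₃₀ , z₃₁ , z₃₂) , S≈S′h) = record
    { a = e f0 f0 ; b = e f1 f0 ; c = e f1 f1
    ; p∤a = p∤-factor (e f0 f0) (e f2 f2) (μ 1) (ω-diagonal₀₂ μ h similitude h₂₀ h₃₀ h₃₂) p∤μ
    ; p∤c = p∤-factor (e f1 f1) (e f3 f3) (μ 1) (ω-diagonal₁₃ μ h similitude h₀₁ h₂₁ h₃₁) p∤μ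
    ; column₀ = λ r → mkₚ (∣-by (drop₂₃ (S r f0 1) (s r f0) (s r f1) (s r f2) (s r f3) (e f0 f0) (e f1 f0) (e f2 f0) (e f3 f0))
                                (S≡S′h r f0 ⊞ s r f2 ⊠ h₂₀ ⊞ s r f3 ⊠ h₃₀))
    ; column₁ = λ r → mkₚ (∣-by (drop₀₂₃ (S r f1 1) (s r f0) (s r f1) (s r f2) (s r f3) (e f0 f1) (e f1 f1) (e f2 f1) (e f3 f1))
                                (S≡S′h r f1 ⊞ s r f0 ⊠ h₀₁ ⊞ s r f2 ⊠ h₂₁ ⊞ s r f3 ⊠ h₃₁))
    }
    where
    open KElement (InK⇒KElement {h} h∈K)
    e s : Fin 4 → Fin 4 → ℤ
    e i j = h i j 1
    s i j = S′ i j 1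
    p∤μ = Unit⇒p∤ μ-unit
    h₀₁ = ZeroModP⇒p∣ (h f0 f1) z₀₁
    h₂₀ = ZeroModP⇒p∣ (h f2 f0) z₂₀
    h₂₁ = ZeroModP⇒p∣ (h f2 f1) z₂₁
    h₃₀ = ZeroModP⇒p∣ (h f3 f0) z₃₀
    h₃₁ = ZeroModP⇒p∣ (h f3 f1) z₃₁
    h₃₂ = ZeroModP⇒p∣ (h f3 f2) z₃₂
    S≡S′h : ∀ r c → p∣ (S r c 1 - (S′ · h) r c 1)
    S≡S′h r c = p∣difference (level₁ (≈⇒≃ {S r c} {(S′ · h) r c} (S≈S′h r c)))
    drop₂₃ : ∀ S s0 s1 s2 s3 h0 h1 h2 h3 → S - (h0 * s0 + h1 * s1) ≡
      (S - (s0 * h0 + s1 * h1 + s2 * h2 + s3 * h3)) + s2 * h2 + s3 * h3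
    drop₂₃ = solve-∀
    drop₀₂₃ : ∀ S s0 s1 s2 s3 h0 h1 h2 h3 → S - h1 * s1 ≡
      (S - (s0 * h0 + s1 * h1 + s2 * h2 + s3 * h3)) + s0 * h0 + s2 * h2 + s3 * h3
    drop₀₂₃ = solve-∀

  dot-congₚ : ∀ x0 x1 x2 x3 {g0 g1 g2 g3 g0′ g1′ g2′ g3′} → g0 ≡ₚ g0′ → g1 ≡ₚ g1′ → g2 ≡ₚ g2′ → g3 ≡ₚ g3′ →
    x0 * g0 + x1 * g1 + x2 * g2 + x3 * g3 ≡ₚ x0 * g0′ + x1 * g1′ + x2 * g2′ + x3 * g3′
  dot-congₚ x0 x1 x2 x3 h0 h1 h2 h3 =
    +-congₚ (+-congₚ (+-congₚ (*-congˡₚ x0 h0) (*-congˡₚ x1 h1)) (*-congˡₚ x2 h2)) (*-congˡₚ x3 h3)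

  ·-column-combination : ∀ (X G S : Mat) {j j₀ j₁} a b → (∀ t → G t j 1 ≡ₚ a * S t j₀ 1 + b * S t j₁ 1) →
    ∀ r → (X · G) r j 1 ≡ₚ a * (X · S) r j₀ 1 + b * (X · S) r j₁ 1
  ·-column-combination X G S {j} {j₀} {j₁} a b H r = ≡ₚ-trans (dot-congₚ (x f0) (x f1) (x f2) (x f3) (H f0) (H f1) (H f2) (H f3))
    (≡⇒≡ₚ (distribute (x f0) (x f1) (x f2) (x f3) (u f0) (u f1) (u f2) (u f3) (w f0) (w f1) (w f2) (w f3) a b))
    where
    x u w : Fin 4 → ℤ
    x t = X r t 1
    u t = S t j₀ 1
    w t = S t j₁ 1
    distribute : ∀ x0 x1 x2 x3 u0 u1 u2 u3 w0 w1 w2 w3 a b →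
      x0 * (a * u0 + b * w0) + x1 * (a * u1 + b * w1) + x2 * (a * u2 + b * w2) + x3 * (a * u3 + b * w3)
      ≡ a * (x0 * u0 + x1 * u1 + x2 * u2 + x3 * u3) + b * (x0 * w0 + x1 * w1 + x2 * w2 + x3 * w3)
    distribute = solve-∀

  ·-column-multiple : ∀ (X G S : Mat) {j j₀} c → (∀ t → G t j 1 ≡ₚ c * S t j₀ 1) →
    ∀ r → (X · G) r j 1 ≡ₚ c * (X · S) r j₀ 1
  ·-column-multiple X G S {j} {j₀} c H r = ≡ₚ-trans (dot-congₚ (x f0) (x f1) (x f2) (x f3) (H f0) (H f1) (H f2) (H f3))
    (≡⇒≡ₚ (distribute (x f0) (x f1) (x f2) (x f3) (u f0) (u f1) (u f2) (u f3) c))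
    where
    x u : Fin 4 → ℤ
    x t = X r t 1
    u t = S t j₀ 1
    distribute : ∀ x0 x1 x2 x3 u0 u1 u2 u3 c →
      x0 * (c * u0) + x1 * (c * u1) + x2 * (c * u2) + x3 * (c * u3) ≡ c * (x0 * u0 + x1 * u1 + x2 * u2 + x3 * u3)
    distribute = solve-∀

  Iwahori-entries : ∀ h μ → Unit μ → IsSimilitude μ h → ∀ a b c →
    (∀ r → h r f0 1 ≡ₚ a * I₄ r f0 1 + b * I₄ r f1 1) → (∀ r → h r f1 1 ≡ₚ c * I₄ r f1 1) →
    ZeroModP p (h f0 f1) × ZeroModP p (h f2 f0) × ZeroModP p (h f2 f1) ×
    ZeroModP p (h f3 f0) × ZeroModP p (h f3 f1) × ZeroModP p (h f3 f2)
  Iwahori-entries h μ μ-unit sim a b c H₀ H₁ =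
    ∣⇒∣ᵤ h01 , ∣⇒∣ᵤ h20 , ∣⇒∣ᵤ h21 , ∣⇒∣ᵤ h30 , ∣⇒∣ᵤ h31 , ∣⇒∣ᵤ h32
    where
    e : Fin 4 → Fin 4 → ℤ
    e i j = h i j 1
    vanish₂ : ∀ a b → a * 0ℤ + b * 0ℤ ≡ 0ℤ
    vanish₂ = solve-∀
    vanish₁ : ∀ c → c * 0ℤ ≡ 0ℤ
    vanish₁ = solve-∀
    h20 = ≡ₚ-zero (H₀ f2) (vanish₂ a b)
    h30 = ≡ₚ-zero (H₀ f3) (vanish₂ a b)
    h01 = ≡ₚ-zero (H₁ f0) (vanish₁ c)
    h21 = ≡ₚ-zero (H₁ f2) (vanish₁ c)
    h31 = ≡ₚ-zero (H₁ f3) (vanish₁ c)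
    ω₁₂ : ∀ h01 h11 h21 h31 h02 h12 h22 h32 μ → h11 * h32 ≡
      ((h01 * h22 + h11 * h32 - h21 * h02 - h31 * h12) - μ * 0ℤ) + (- h22) * h01 + h02 * h21 + h12 * h31
    ω₁₂ = solve-∀
    -- ω(h e₁, h e₂) ≡ 0 forces h₁₁ h₃₂ ≡ 0, while ω(h e₁, h e₃) ≡ μ makes h₁₁ a unit.
    h32 : p∣ (e f3 f2)
    h32 = p∣-cancelˡ (e f1 f1) (e f3 f2)
      (p∤-factor (e f1 f1) (e f3 f3) (μ 1) (ω-diagonal₁₃ μ h sim h01 h21 h31) (Unit⇒p∤ μ-unit))
      (∣-by (ω₁₂ (e f0 f1) (e f1 f1) (e f2 f1) (e f3 f1) (e f0 f2) (e f1 f2) (e f2 f2) (e f3 f2) (μ 1))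
            (p∣difference (ω-relation μ h sim f1 f2) ⊞ (- e f2 f2) ⊠ h01 ⊞ e f0 f2 ⊠ h21 ⊞ e f1 f2 ⊠ h31))

  columns⇒InCoset : ∀ {s} → GSp₄ s → ∀ g → InK p g → ∀ a b c →
    (∀ r → g r f0 1 ≡ₚ a * s r f0 1 + b * s r f1 1) → (∀ r → g r f1 1 ≡ₚ c * s r f1 1) → InCoset p g s
  columns⇒InCoset {s} S g g∈K a b c H₀ H₁ =
    h , (KElement⇒InK (mkKElement h-integral (G.μ ⊗ S.ν) h-unit h-similitude) ,
         Iwahori-entries h (G.μ ⊗ S.ν) h-unit h-similitude a b c h-column₀ h-column₁) ,
    λ i j → ≃⇒≈ (entry-≃ g≈sh i j)
    where
    module S = GSp₄ S
    module G = KElement (InK⇒KElement {g} g∈K)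
    h = S.s⁻¹ · g
    h-integral = ·-integral S.integral⁻¹ G.integral
    h-unit = Unit-⊗ G.μ-unit S.ν-unit
    h-similitude = similitude-· S.ν G.μ S.s⁻¹ g S.similitude⁻¹ G.similitude
    s⁻¹s≡I : ∀ r j → (S.s⁻¹ · s) r j 1 ≡ₚ I₄ r j 1
    s⁻¹s≡I r j = level₁ (entry-≃ S.inverseˡ r j)
    h-column₀ : ∀ r → h r f0 1 ≡ₚ a * I₄ r f0 1 + b * I₄ r f1 1
    h-column₀ r = ≡ₚ-trans (·-column-combination S.s⁻¹ g s a b H₀ r)
                          (+-congₚ (*-congˡₚ a (s⁻¹s≡I r f0)) (*-congˡₚ b (s⁻¹s≡I r f1)))
    h-column₁ : ∀ r → h r f1 1 ≡ₚ c * I₄ r f1 1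
    h-column₁ r = ≡ₚ-trans (·-column-multiple S.s⁻¹ g s c H₁ r) (*-congˡₚ c (s⁻¹s≡I r f1))
    g≈sh : g ≈ₘ s · h
    g≈sh = ≈ₘ-sym (≈ₘ-trans (≈ₘ-sym (≐⇒≈ₘ (·-assoc s S.s⁻¹ g)))
                            (≈ₘ-trans (·-congˡ g S.inverseʳ) (≐⇒≈ₘ (·-identityˡ g))))

column⁴ : ℤ → ℤ → ℤ → ℤ → Column
column⁴ a b c d zero = a
column⁴ a b c d (suc zero) = b
column⁴ a b c d (suc (suc zero)) = c
column⁴ a b c d (suc (suc (suc zero))) = d

Z-action : ∀ {m} → Maybe (Fin m) → Flag → Flag
Z-action (just y) (β₀ , β₁) = β₀ , λ r → + toℕ y * β₀ r + β₁ r
Z-action nothing (β₀ , β₁) = β₁ , β₀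

·Z-flag : ∀ {m} (X : Mat) (y : Maybe (Fin m)) → flagOf (X · Z y) ≗ᶠ Z-action y (flagOf X)
·Z-flag X (just y) r = col₀ (X r f0 1) (X r f1 1) (X r f2 1) (X r f3 1) , col₁ (X r f0 1) (X r f1 1) (X r f2 1) (X r f3 1) (+ toℕ y)
  where
  col₀ : ∀ a b c d → a * 1ℤ + b * 0ℤ + c * 0ℤ + d * 0ℤ ≡ a
  col₀ = solve-∀
  col₁ : ∀ a b c d y → a * y + b * 1ℤ + c * 0ℤ + d * 0ℤ ≡ y * a + b
  col₁ = solve-∀
·Z-flag X nothing r = col₀ (X r f0 1) (X r f1 1) (X r f2 1) (X r f3 1) , col₁ (X r f0 1) (X r f1 1) (X r f2 1) (X r f3 1)
  where
  col₀ : ∀ a b c d → a * 0ℤ + b * 1ℤ + c * 0ℤ + d * 0ℤ ≡ b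
  col₀ = solve-∀
  col₁ : ∀ a b c d → a * 1ℤ + b * 0ℤ + c * 0ℤ + d * 0ℤ ≡ a
  col₁ = solve-∀

minor : Fin 4 → Fin 4 → Flag → ℤ
minor i j (C₀ , C₁) = C₀ i * C₁ j - C₀ j * C₁ i

Z-action-cong : ∀ {m} (y : Maybe (Fin m)) {F G} → F ≗ᶠ G → Z-action y F ≗ᶠ Z-action y G
Z-action-cong (just y) e r = proj₁ (e r) , cong₂ (λ u v → + toℕ y * u + v) (proj₁ (e r)) (proj₂ (e r))
Z-action-cong nothing e r = proj₂ (e r) , proj₁ (e r)

·J-column₀ : ∀ (X : Mat) r → (X · Jm) r f0 1 ≡ - X r f2 1
·J-column₀ X r = pick (X r f0 1) (X r f1 1) (X r f2 1) (X r f3 1)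
  where
  pick : ∀ a b c d → a * 0ℤ + b * 0ℤ + c * -1ℤ + d * 0ℤ ≡ - c
  pick = solve-∀

·J-column₁ : ∀ (X : Mat) r → (X · Jm) r f1 1 ≡ - X r f3 1
·J-column₁ X r = pick (X r f0 1) (X r f1 1) (X r f2 1) (X r f3 1)
  where
  pick : ∀ a b c d → a * 0ℤ + b * 0ℤ + c * 0ℤ + d * -1ℤ ≡ - d
  pick = solve-∀

J·-column : ∀ (Y : Mat) j r → (Jm · Y) r j 1 ≡ column⁴ (Y f2 j 1) (Y f3 j 1) (- Y f0 j 1) (- Y f1 j 1) r
J·-column Y j zero = pick (Y f0 j 1) (Y f1 j 1) (Y f2 j 1) (Y f3 j 1)
  where pick : ∀ a b c d → 0ℤ * a + 0ℤ * b + 1ℤ * c + 0ℤ * d ≡ c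
        pick = solve-∀
J·-column Y j (suc zero) = pick (Y f0 j 1) (Y f1 j 1) (Y f2 j 1) (Y f3 j 1)
  where pick : ∀ a b c d → 0ℤ * a + 0ℤ * b + 0ℤ * c + 1ℤ * d ≡ d
        pick = solve-∀
J·-column Y j (suc (suc zero)) = pick (Y f0 j 1) (Y f1 j 1) (Y f2 j 1) (Y f3 j 1)
  where pick : ∀ a b c d → -1ℤ * a + 0ℤ * b + 0ℤ * c + 0ℤ * d ≡ - a
        pick = solve-∀
J·-column Y j (suc (suc (suc zero))) = pick (Y f0 j 1) (Y f1 j 1) (Y f2 j 1) (Y f3 j 1)
  where pick : ∀ a b c d → 0ℤ * a + -1ℤ * b + 0ℤ * c + 0ℤ * d ≡ - b
        pick = solve-∀

A-flag B-flag : ∀ {m} → Fin m → Fin m → Fin m → Flag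
A-flag n q r = column⁴ (- + toℕ n) (- + toℕ q) -1ℤ 0ℤ , column⁴ (- + toℕ q) (- + toℕ r) 0ℤ -1ℤ
B-flag n q r = column⁴ -1ℤ 0ℤ (+ toℕ n) (+ toℕ q) , column⁴ 0ℤ -1ℤ (+ toℕ q) (+ toℕ r)

D-flag : ∀ {m} → Maybe (Fin m) → Flag
D-flag (just zero) = column⁴ 0ℤ -1ℤ 0ℤ 0ℤ , column⁴ 0ℤ 0ℤ 1ℤ 0ℤ
D-flag (just (suc l)) = column⁴ (- + suc (toℕ l)) 1ℤ 0ℤ 0ℤ , column⁴ 0ℤ 0ℤ 1ℤ (+ suc (toℕ l))
D-flag nothing = column⁴ -1ℤ 0ℤ 0ℤ 0ℤ , column⁴ 0ℤ 0ℤ 0ℤ 1ℤ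

UJ-flag : ∀ {m} (n q r : Fin m) → flagOf (U n q r · Jm) ≗ᶠ A-flag n q r
UJ-flag n q r = ≗ᶠ-byRows (row f0) (row f1) (row f2) (row f3)
  where
  row : ∀ t → (U n q r · Jm) t f0 1 ≡ - U n q r t f2 1 × (U n q r · Jm) t f1 1 ≡ - U n q r t f3 1
  row t = ·J-column₀ (U n q r) t , ·J-column₁ (U n q r) t

JUJ-flag : ∀ {m} (n q r : Fin m) → flagOf (Jm · U n q r · Jm) ≗ᶠ B-flag n q r
JUJ-flag n q r t = trans (·J-column₀ (Jm · U n q r) t) (trans (cong -_ (J·-column (U n q r) f2 t)) (entry₀ t)) ,
                   trans (·J-column₁ (Jm · U n q r) t) (trans (cong -_ (J·-column (U n q r) f3 t)) (entry₁ t))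
  where
  entry₀ : ∀ t → - column⁴ 1ℤ 0ℤ (- + toℕ n) (- + toℕ q) t ≡ proj₁ (B-flag n q r) t
  entry₀ zero = refl
  entry₀ (suc zero) = refl
  entry₀ (suc (suc zero)) = ℤP.neg-involutive _
  entry₀ (suc (suc (suc zero))) = ℤP.neg-involutive _
  entry₁ : ∀ t → - column⁴ 0ℤ 1ℤ (- + toℕ q) (- + toℕ r) t ≡ proj₂ (B-flag n q r) t
  entry₁ zero = refl
  entry₁ (suc zero) = refl
  entry₁ (suc (suc zero)) = ℤP.neg-involutive _
  entry₁ (suc (suc (suc zero))) = ℤP.neg-involutive _

D-base-flag : ∀ {m} (inv : ℕ → Seq) (l : Maybe (Fin m)) → flagOf (Dl inv l) ≗ᶠ D-flag l
D-base-flag inv (just zero) = ≗ᶠ-byRows (refl , refl) (refl , refl) (refl , refl) (refl , refl)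
D-base-flag inv (just (suc l)) = ≗ᶠ-byRows (refl , refl) (refl , refl) (refl , refl) (refl , refl)
D-base-flag inv nothing = ≗ᶠ-byRows (refl , refl) (refl , refl) (refl , refl) (refl , refl)

zIndex : ∀ {m} → Idx m → Maybe (Fin m)
zIndex (A _ _ _ y) = y
zIndex (B _ _ _ y) = y
zIndex (D _ y) = y

baseFlag : ∀ {m} → Idx m → Flag
baseFlag (A n q r _) = A-flag n q r
baseFlag (B n q r _) = B-flag n q r
baseFlag (D l _) = D-flag l

flag : ∀ {m} → Idx m → Flag
flag i = Z-action (zIndex i) (baseFlag i)

rep-flag : ∀ {m} (inv : ℕ → Seq) (i : Idx m) → flagOf (rep inv i) ≗ᶠ flag i
rep-flag inv (A n q r y) = ≗ᶠ-trans (·Z-flag (U n q r · Jm) y) (Z-action-cong y (UJ-flag n q r))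
rep-flag inv (B n q r y) = ≗ᶠ-trans (·Z-flag (Jm · U n q r · Jm) y) (Z-action-cong y (JUJ-flag n q r))
rep-flag inv (D l y) = ≗ᶠ-trans (·Z-flag (Dl inv l) y) (Z-action-cong y (D-base-flag inv l))

-- Multiplication by J⁻¹.
rotate : Column → Column
rotate v = column⁴ (- v f2) (- v f3) (v f0) (v f1)

rotateᶠ : Flag → Flag
rotateᶠ (C₀ , C₁) = rotate C₀ , rotate C₁

rotate-B-flag : ∀ {m} (n q r : Fin m) y → rotateᶠ (flag (B n q r y)) ≗ᶠ flag (A n q r y)
rotate-B-flag n q r (just y) = ≗ᶠ-byRows (refl , distribute (+ toℕ y) (+ toℕ n) (+ toℕ q))
  (refl , distribute (+ toℕ y) (+ toℕ q) (+ toℕ r)) (refl , refl) (refl , refl)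
  where
  distribute : ∀ y n q → - (y * n + q) ≡ y * (- n) + (- q)
  distribute = solve-∀
rotate-B-flag n q r nothing = ≗ᶠ-byRows (refl , refl) (refl , refl) (refl , refl) (refl , refl)

pivot : ∀ {m} → Maybe (Fin m) → Fin 4
pivot (just _) = f2
pivot nothing = f3

D-flag-pivot : ∀ {m} (l : Maybe (Fin m)) → proj₂ (D-flag l) (pivot l) ≡ 1ℤ
D-flag-pivot (just zero) = refl
D-flag-pivot (just (suc _)) = refl
D-flag-pivot nothing = refl

D-flag-top : ∀ {m m′} (l : Maybe (Fin m)) (l′ : Maybe (Fin m′)) → proj₁ (D-flag l) (pivot l′) ≡ 0ℤ
D-flag-top (just zero) (just _) = refl
D-flag-top (just (suc _)) (just _) = refl
D-flag-top nothing (just _) = refl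
D-flag-top (just zero) nothing = refl
D-flag-top (just (suc _)) nothing = refl
D-flag-top nothing nothing = refl

top-pivot : ∀ {m} → Maybe (Fin m) → Fin 4
top-pivot (just _) = f1
top-pivot nothing = f0

D-flag-top-pivot : ∀ {m} (l : Maybe (Fin m)) →
  proj₂ (D-flag l) (top-pivot l) ≡ 0ℤ × (proj₁ (D-flag l) (top-pivot l) ≡ 1ℤ ⊎ proj₁ (D-flag l) (top-pivot l) ≡ -1ℤ)
D-flag-top-pivot (just zero) = refl , inj₂ refl
D-flag-top-pivot (just (suc _)) = refl , inj₁ refl
D-flag-top-pivot nothing = refl , inj₂ refl

-- Uniqueness

module Uniqueness (p : ℕ) (p-prime : Prime p) where
  open ResidueField p p-prime
  open Cosets p p-prime

  cong-A : ∀ {m} {n q r n′ q′ r′ : Fin m} {y y′} → n ≡ n′ → q ≡ q′ → r ≡ r′ → y ≡ y′ → A n q r y ≡ A n′ q′ r′ y′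
  cong-A refl refl refl refl = refl

  -- With a ≡ 1, b ≡ 0, c ≡ 1 read off the rows 2 and 3, the remaining rows give the parameters.
  A-injective : ∀ (n q r : Fin p) y (n′ q′ r′ : Fin p) y′ → SameFlag (flag (A n q r y)) (flag (A n′ q′ r′ y′)) → A n q r y ≡ A n′ q′ r′ y′
  A-injective n q r (just y) n′ q′ r′ (just y′) R =
    cong-A (residues-distinct n n′ n≡n′) (residues-distinct q q′ q≡q′) (residues-distinct r r′ r≡r′)
           (cong just (residues-distinct y y′ y≡y′))
    where
    open SameFlag R
    N = + toℕ n ; Q = + toℕ q ; Rr = + toℕ r ; Y = + toℕ y
    N′ = + toℕ n′ ; Q′ = + toℕ q′ ; R′ = + toℕ r′ ; Y′ = + toℕ y′
    b≡0 : p∣ b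
    b≡0 = ∣-by (cert a b Y′) (p∣column₀ f3)
      where cert : ∀ a b y′ → b ≡ 0ℤ - (a * 0ℤ + b * (y′ * 0ℤ + -1ℤ))
            cert = solve-∀
    a≡1 : p∣ (a - 1ℤ)
    a≡1 = ∣-by (cert a b Y′) (p∣column₀ f2 ⊞ (- Y′) ⊠ b≡0)
      where cert : ∀ a b y′ → a - 1ℤ ≡ (-1ℤ - (a * -1ℤ + b * (y′ * -1ℤ + 0ℤ))) + (- y′) * b
            cert = solve-∀
    c≡1 : p∣ (c - 1ℤ)
    c≡1 = ∣-by (cert c Y Y′) (p∣column₁ f3)
      where cert : ∀ c y y′ → c - 1ℤ ≡ (y * 0ℤ + -1ℤ) - c * (y′ * 0ℤ + -1ℤ)
            cert = solve-∀
    y≡y′ : p∣ (Y - Y′)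
    y≡y′ = ∣-by (cert c Y Y′) (-1ℤ ⊠ p∣column₁ f2 ⊞ Y′ ⊠ c≡1)
      where cert : ∀ c y y′ → y - y′ ≡ -1ℤ * ((y * -1ℤ + 0ℤ) - c * (y′ * -1ℤ + 0ℤ)) + y′ * (c - 1ℤ)
            cert = solve-∀
    cert₀₁ : ∀ a b n y′ n′ q′ → n - n′ ≡ -1ℤ * ((- n) - (a * (- n′) + b * (y′ * (- n′) + (- q′)))) + n′ * (a - 1ℤ) + (y′ * n′ + q′) * b
    cert₀₁ = solve-∀
    n≡n′ : p∣ (N - N′)
    n≡n′ = ∣-by (cert₀₁ a b N Y′ N′ Q′) (-1ℤ ⊠ p∣column₀ f0 ⊞ N′ ⊠ a≡1 ⊞ (Y′ * N′ + Q′) ⊠ b≡0)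
    q≡q′ : p∣ (Q - Q′)
    q≡q′ = ∣-by (cert₀₁ a b Q Y′ Q′ R′) (-1ℤ ⊠ p∣column₀ f1 ⊞ Q′ ⊠ a≡1 ⊞ (Y′ * Q′ + R′) ⊠ b≡0)
    r≡r′ : p∣ (Rr - R′)
    r≡r′ = ∣-by (cert c Y Y′ Q Q′ Rr R′) (-1ℤ ⊠ p∣column₁ f1 ⊞ (R′ + Y′ * Q′) ⊠ c≡1 ⊞ (- Y) ⊠ q≡q′ ⊞ (- Q′) ⊠ y≡y′)
      where cert : ∀ c y y′ q q′ r r′ → r - r′ ≡ -1ℤ * ((y * (- q) + (- r)) - c * (y′ * (- q′) + (- r′)))
                     + (r′ + y′ * q′) * (c - 1ℤ) + (- y) * (q - q′) + (- q′) * (y - y′)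
            cert = solve-∀
  A-injective n q r nothing n′ q′ r′ nothing R =
    cong-A (residues-distinct n n′ n≡n′) (residues-distinct q q′ q≡q′) (residues-distinct r r′ r≡r′) refl
    where
    open SameFlag R
    N = + toℕ n ; Q = + toℕ q ; Rr = + toℕ r
    N′ = + toℕ n′ ; Q′ = + toℕ q′ ; R′ = + toℕ r′
    b≡0 : p∣ b
    b≡0 = ∣-by (cert a b) (p∣column₀ f2)
      where cert : ∀ a b → b ≡ 0ℤ - (a * 0ℤ + b * -1ℤ)
            cert = solve-∀
    a≡1 : p∣ (a - 1ℤ)
    a≡1 = ∣-by (cert a b) (p∣column₀ f3)
      where cert : ∀ a b → a - 1ℤ ≡ -1ℤ - (a * -1ℤ + b * 0ℤ)
            cert = solve-∀
    c≡1 : p∣ (c - 1ℤ)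
    c≡1 = ∣-by (cert c) (p∣column₁ f2)
      where cert : ∀ c → c - 1ℤ ≡ -1ℤ - c * -1ℤ
            cert = solve-∀
    cert₁ : ∀ c n n′ → n - n′ ≡ -1ℤ * ((- n) - c * (- n′)) + n′ * (c - 1ℤ)
    cert₁ = solve-∀
    n≡n′ : p∣ (N - N′)
    n≡n′ = ∣-by (cert₁ c N N′) (-1ℤ ⊠ p∣column₁ f0 ⊞ N′ ⊠ c≡1)
    q≡q′ : p∣ (Q - Q′)
    q≡q′ = ∣-by (cert₁ c Q Q′) (-1ℤ ⊠ p∣column₁ f1 ⊞ Q′ ⊠ c≡1)
    r≡r′ : p∣ (Rr - R′)
    r≡r′ = ∣-by (cert a b Rr R′ Q′) (-1ℤ ⊠ p∣column₀ f1 ⊞ R′ ⊠ a≡1 ⊞ Q′ ⊠ b≡0)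
      where cert : ∀ a b r r′ q′ → r - r′ ≡ -1ℤ * ((- r) - (a * (- r′) + b * (- q′))) + r′ * (a - 1ℤ) + q′ * b
            cert = solve-∀
  A-injective n q r (just y) n′ q′ r′ nothing R = ⊥-elim (p∤1 (∣-by (cert (+ toℕ y) c) (-1ℤ ⊠ p∣column₁ f3)))
    where
    open SameFlag R
    cert : ∀ y c → 1ℤ ≡ -1ℤ * ((y * 0ℤ + -1ℤ) - c * 0ℤ)
    cert = solve-∀
  A-injective n q r nothing n′ q′ r′ (just y′) R = ⊥-elim (p∤c (∣-by (cert c (+ toℕ y′)) (p∣column₁ f3)))
    where
    open SameFlag R
    cert : ∀ c y′ → c ≡ 0ℤ - c * (y′ * 0ℤ + -1ℤ)
    cert = solve-∀

  SameFlag-rotate : ∀ {F G} → SameFlag F G → SameFlag (rotateᶠ F) (rotateᶠ G)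
  SameFlag-rotate {F₀ , F₁} {G₀ , G₁} R = record
    { a = a ; b = b ; c = c ; p∤a = p∤a ; p∤c = p∤c
    ; column₀ = λ { zero → negated₀ f2 ; (suc zero) → negated₀ f3 ; (suc (suc zero)) → column₀ f0
                  ; (suc (suc (suc zero))) → column₀ f1 }
    ; column₁ = λ { zero → negated₁ f2 ; (suc zero) → negated₁ f3 ; (suc (suc zero)) → column₁ f0
                  ; (suc (suc (suc zero))) → column₁ f1 }
    }
    where
    open SameFlag R
    negated₀ : ∀ t → - F₀ t ≡ₚ a * (- G₀ t) + b * (- G₁ t)
    negated₀ t = ≡ₚ-trans (-‿congₚ (column₀ t)) (≡⇒≡ₚ (distribute a b (G₀ t) (G₁ t)))
      where distribute : ∀ a b x y → - (a * x + b * y) ≡ a * (- x) + b * (- y)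
            distribute = solve-∀
    negated₁ : ∀ t → - F₁ t ≡ₚ c * (- G₁ t)
    negated₁ t = ≡ₚ-trans (-‿congₚ (column₁ t)) (≡⇒≡ₚ (ℤP.neg-distribʳ-* c (G₁ t)))

  B-injective : ∀ (n q r : Fin p) y (n′ q′ r′ : Fin p) y′ → SameFlag (flag (B n q r y)) (flag (B n′ q′ r′ y′)) →
    B n q r y ≡ B n′ q′ r′ y′
  B-injective n q r y n′ q′ r′ y′ R with A-injective n q r y n′ q′ r′ y′
    (SameFlag-resp (rotate-B-flag n q r y) (rotate-B-flag n′ q′ r′ y′) (SameFlag-rotate R))
  ... | refl = refl

  p∤suc : ∀ {n} → suc n ℕ.< p → p∤ (+ suc n)
  p∤suc n<p d with p∣-<p⇒≡0 n<p (∣⇒∣ᵤ d)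
  ... | ()

  D-λ-injective : ∀ (l l′ : V p) κ → p∤ κ →
    proj₁ (D-flag l) f0 ≡ₚ κ * proj₁ (D-flag l′) f0 → proj₁ (D-flag l) f1 ≡ₚ κ * proj₁ (D-flag l′) f1 → l ≡ l′
  D-λ-injective (just zero) (just zero) κ p∤κ e₀ e₁ = refl
  D-λ-injective nothing nothing κ p∤κ e₀ e₁ = refl
  D-λ-injective (just (suc l)) (just (suc l′)) κ p∤κ e₀ e₁ =
    cong just (residues-distinct (suc l) (suc l′) (∣-by (cert κ (+ suc (toℕ l)) (+ suc (toℕ l′)))
      (-1ℤ ⊠ p∣difference e₀ ⊞ (+ suc (toℕ l′)) ⊠ (-1ℤ ⊠ p∣difference e₁))))
    where cert : ∀ κ l l′ → l - l′ ≡ -1ℤ * ((- l) - κ * (- l′)) + l′ * (-1ℤ * (1ℤ - κ * 1ℤ))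
          cert = solve-∀
  D-λ-injective (just (suc l)) (just zero) κ p∤κ e₀ e₁ = ⊥-elim (p∤suc (FP.toℕ<n (suc l))
    (∣-by (cert κ (+ suc (toℕ l))) (-1ℤ ⊠ p∣difference e₀)))
    where cert : ∀ κ l → l ≡ -1ℤ * ((- l) - κ * 0ℤ)
          cert = solve-∀
  D-λ-injective (just (suc l)) nothing κ p∤κ e₀ e₁ = ⊥-elim (p∤1 (∣-by (cert κ) (p∣difference e₁)))
    where cert : ∀ κ → 1ℤ ≡ 1ℤ - κ * 0ℤ
          cert = solve-∀
  D-λ-injective (just zero) (just (suc l′)) κ p∤κ e₀ e₁ = ⊥-elim (p∤suc (FP.toℕ<n (suc l′))
    (p∣-cancelˡ κ (+ suc (toℕ l′)) p∤κ (∣-by (cert κ (+ suc (toℕ l′))) (p∣difference e₀))))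
    where cert : ∀ κ l′ → κ * l′ ≡ 0ℤ - κ * (- l′)
          cert = solve-∀
  D-λ-injective (just zero) nothing κ p∤κ e₀ e₁ = ⊥-elim (p∤1 (∣-by (cert κ) (-1ℤ ⊠ p∣difference e₁)))
    where cert : ∀ κ → 1ℤ ≡ -1ℤ * (-1ℤ - κ * 0ℤ)
          cert = solve-∀
  D-λ-injective nothing (just (suc l′)) κ p∤κ e₀ e₁ = ⊥-elim (p∤κ (∣-by (cert κ) (-1ℤ ⊠ p∣difference e₁)))
    where cert : ∀ κ → κ ≡ -1ℤ * (0ℤ - κ * 1ℤ)
          cert = solve-∀
  D-λ-injective nothing (just zero) κ p∤κ e₀ e₁ = ⊥-elim (p∤κ (∣-by (cert κ) (p∣difference e₁)))
    where cert : ∀ κ → κ ≡ 0ℤ - κ * -1ℤ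
          cert = solve-∀

  D-finite-b≡0 : ∀ (l : V p) y (l′ : V p) y′ (R : SameFlag (flag (D l (just y))) (flag (D l′ (just y′)))) →
    p∣ SameFlag.b R
  D-finite-b≡0 l y l′ y′ R = at-pivot (D-flag-top l l′) (D-flag-top l′ l′) (D-flag-pivot l′) (p∣column₀ (pivot l′))
    where
    open SameFlag R
    at-pivot : ∀ {x x′ w} → x ≡ 0ℤ → x′ ≡ 0ℤ → w ≡ 1ℤ → p∣ (x - (a * x′ + b * (+ toℕ y′ * x′ + w))) → p∣ b
    at-pivot refl refl refl d = ∣-by (cert a b (+ toℕ y′)) (-1ℤ ⊠ d)
      where cert : ∀ a b y′ → b ≡ -1ℤ * (0ℤ - (a * 0ℤ + b * (y′ * 0ℤ + 1ℤ)))
            cert = solve-∀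

  D-finite≢∞ : ∀ (l : V p) y (l′ : V p) → ¬ SameFlag (flag (D l (just y))) (flag (D l′ nothing))
  D-finite≢∞ l y l′ R = at-pivot (D-flag-top l l) (D-flag-pivot l) (D-flag-top l′ l) (p∣column₁ (pivot l))
    where
    open SameFlag R
    at-pivot : ∀ {x w x′} → x ≡ 0ℤ → w ≡ 1ℤ → x′ ≡ 0ℤ → p∣ ((+ toℕ y * x + w) - c * x′) → ⊥
    at-pivot refl refl refl d = p∤1 (∣-by (cert (+ toℕ y) c) d)
      where cert : ∀ y c → 1ℤ ≡ (y * 0ℤ + 1ℤ) - c * 0ℤ
            cert = solve-∀

  D-∞≢finite : ∀ (l : V p) (l′ : V p) y′ → ¬ SameFlag (flag (D l nothing)) (flag (D l′ (just y′)))
  D-∞≢finite l l′ y′ R = at-pivot (D-flag-top l l′) (D-flag-top l′ l′) (D-flag-pivot l′) (p∣column₁ (pivot l′))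
    where
    open SameFlag R
    at-pivot : ∀ {x x′ w} → x ≡ 0ℤ → x′ ≡ 0ℤ → w ≡ 1ℤ → p∣ (x - c * (+ toℕ y′ * x′ + w)) → ⊥
    at-pivot refl refl refl d = p∤c (∣-by (cert c (+ toℕ y′)) (-1ℤ ⊠ d))
      where cert : ∀ c y′ → c ≡ -1ℤ * (0ℤ - c * (y′ * 0ℤ + 1ℤ))
            cert = solve-∀

  p∤±1 : ∀ {s} → s ≡ 1ℤ ⊎ s ≡ -1ℤ → p∤ s
  p∤±1 (inj₁ refl) = p∤1
  p∤±1 (inj₂ refl) d = p∤1 (∣-by refl (-1ℤ ⊠ d))

  D-y-injective : ∀ (l : V p) y y′ → SameFlag (flag (D l (just y))) (flag (D l (just y′))) → y ≡ y′
  D-y-injective l y y′ R = residues-distinct y y′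
    (row-top (proj₁ (D-flag-top-pivot l)) (p∤±1 (proj₂ (D-flag-top-pivot l))) (p∣column₁ (top-pivot l)))
    where
    open SameFlag R
    Y = + toℕ y
    Y′ = + toℕ y′
    row-bottom : ∀ {x w} → x ≡ 0ℤ → w ≡ 1ℤ → p∣ ((Y * x + w) - c * (Y′ * x + w)) → p∣ (c - 1ℤ)
    row-bottom refl refl d = ∣-by (cert c Y Y′) (-1ℤ ⊠ d)
      where cert : ∀ c y y′ → c - 1ℤ ≡ -1ℤ * ((y * 0ℤ + 1ℤ) - c * (y′ * 0ℤ + 1ℤ))
            cert = solve-∀
    c≡1 : p∣ (c - 1ℤ)
    c≡1 = row-bottom (D-flag-top l l) (D-flag-pivot l) (p∣column₁ (pivot l))
    row-top : ∀ {z s} → z ≡ 0ℤ → p∤ s → p∣ ((Y * s + z) - c * (Y′ * s + z)) → p∣ (Y - Y′)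
    row-top {s = s} refl p∤s d = p∣-cancelˡ s (Y - Y′) p∤s (∣-by (cert c Y Y′ s) (d ⊞ (Y′ * s) ⊠ c≡1))
      where cert : ∀ c y y′ s → s * (y - y′) ≡ ((y * s + 0ℤ) - c * (y′ * s + 0ℤ)) + (y′ * s) * (c - 1ℤ)
            cert = solve-∀

  D-finite-top : ∀ (l : V p) y (l′ : V p) y′ (R : SameFlag (flag (D l (just y))) (flag (D l′ (just y′)))) →
    ∀ t → proj₁ (D-flag l) t ≡ₚ SameFlag.a R * proj₁ (D-flag l′) t
  D-finite-top l y l′ y′ R t =
    mkₚ (∣-by (cert (proj₁ (D-flag l) t) a (proj₁ (D-flag l′) t) b (+ toℕ y′) (proj₂ (D-flag l′) t))
              (p∣column₀ t ⊞ (+ toℕ y′ * proj₁ (D-flag l′) t + proj₂ (D-flag l′) t) ⊠ D-finite-b≡0 l y l′ y′ R))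
    where
    open SameFlag R
    cert : ∀ x a x′ b y′ z → x - a * x′ ≡ (x - (a * x′ + b * (y′ * x′ + z))) + (y′ * x′ + z) * b
    cert = solve-∀

  D-injective : ∀ (l : V p) y (l′ : V p) y′ → SameFlag (flag (D l y)) (flag (D l′ y′)) → D l y ≡ D l′ y′
  D-injective l (just y) l′ (just y′) R
    with D-λ-injective l l′ (SameFlag.a R) (SameFlag.p∤a R) (D-finite-top l y l′ y′ R f0) (D-finite-top l y l′ y′ R f1)
  ... | refl = cong (λ z → D l (just z)) (D-y-injective l y y′ R)
  D-injective l nothing l′ nothing R =
    cong (λ z → D z nothing) (D-λ-injective l l′ (SameFlag.c R) (SameFlag.p∤c R) (SameFlag.column₁ R f0) (SameFlag.column₁ R f1))
  D-injective l (just y) l′ nothing R = ⊥-elim (D-finite≢∞ l y l′ R)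
  D-injective l nothing l′ (just y′) R = ⊥-elim (D-∞≢finite l l′ y′ R)

  ac : ∀ {F G} → SameFlag F G → ℤ
  ac R = SameFlag.a R * SameFlag.c R

  p∤ac : ∀ {F G} (R : SameFlag F G) → p∤ ac R
  p∤ac R = p∤-* (SameFlag.p∤a R) (SameFlag.p∤c R)

  SameFlag-minor : ∀ i j {F G} (R : SameFlag F G) → minor i j F ≡ₚ ac R * minor i j G
  SameFlag-minor i j {F} {G₀ , G₁} R =
    ≡ₚ-trans (minus-congₚ (*-congₚ (column₀ i) (column₁ j)) (*-congₚ (column₀ j) (column₁ i)))
             (≡⇒≡ₚ (expand a b c (G₀ i) (G₀ j) (G₁ i) (G₁ j)))
    where
    open SameFlag R
    expand : ∀ a b c x₀ x₁ y₀ y₁ → (a * x₀ + b * y₀) * (c * y₁) - (a * x₁ + b * y₁) * (c * y₀) ≡ (a * c) * (x₀ * y₁ - x₁ * y₀)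
    expand = solve-∀

  unit-minor : ∀ y → -1ℤ * (y * 0ℤ + -1ℤ) - 0ℤ * (y * -1ℤ + 0ℤ) ≡ 1ℤ
  unit-minor = solve-∀

  A-bottom-unit : ∀ (n q r : Fin p) y → p∤ minor f2 f3 (flag (A n q r y))
  A-bottom-unit n q r (just y) d = p∤1 (∣-by (sym (unit-minor (+ toℕ y))) d)
  A-bottom-unit n q r nothing = p∤±1 (inj₂ refl)

  B-top-unit : ∀ (n q r : Fin p) y → p∤ minor f0 f1 (flag (B n q r y))
  B-top-unit n q r (just y) d = p∤1 (∣-by (sym (unit-minor (+ toℕ y))) d)
  B-top-unit n q r nothing = p∤±1 (inj₂ refl)

  B-bottom-vanishes : ∀ (n q r : Fin p) y → ValidIdx (B n q r y) → p∣ minor f2 f3 (flag (B n q r y))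
  B-bottom-vanishes n q r (just y) valid = ∣-by (cert (+ toℕ n) (+ toℕ q) (+ toℕ r) (+ toℕ y)) (-1ℤ ⊠ ∣ᵤ⇒∣ valid)
    where cert : ∀ n q r y → n * (y * q + r) - q * (y * n + q) ≡ -1ℤ * (q * q - n * r)
          cert = solve-∀
  B-bottom-vanishes n q r nothing valid = ∣-by (cert (+ toℕ n) (+ toℕ q) (+ toℕ r)) (∣ᵤ⇒∣ valid)
    where cert : ∀ n q r → q * q - r * n ≡ q * q - n * r
          cert = solve-∀

  zeroˡ : ∀ u v → 0ℤ * u - 0ℤ * v ≡ 0ℤ
  zeroˡ = solve-∀

  zeroʳ : ∀ u v → u * 0ℤ - v * 0ℤ ≡ 0ℤ
  zeroʳ = solve-∀

  twisted : ∀ a b y → a * (y * b + 0ℤ) - b * (y * a + 0ℤ) ≡ 0ℤ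
  twisted = solve-∀

  D-minors-vanish : ∀ (l : V p) y → minor f2 f3 (flag (D l y)) ≡ 0ℤ × minor f0 f1 (flag (D l y)) ≡ 0ℤ
  D-minors-vanish (just zero) (just y) = zeroˡ (v f3) (v f2) , twisted (u f0) (u f1) (+ toℕ y)
    where u v : Column
          u = proj₁ (D-flag {p} (just zero))
          v = proj₂ (flag (D (just zero) (just y)))
  D-minors-vanish (just (suc l)) (just y) = zeroˡ (v f3) (v f2) , twisted (u f0) (u f1) (+ toℕ y)
    where u v : Column
          u = proj₁ (D-flag {p} (just (suc l)))
          v = proj₂ (flag (D (just (suc l)) (just y)))
  D-minors-vanish nothing (just y) = zeroˡ (v f3) (v f2) , twisted (u f0) (u f1) (+ toℕ y)
    where u v : Column
          u = proj₁ (D-flag {p} nothing)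
          v = proj₂ (flag (D nothing (just y)))
  D-minors-vanish (just zero) nothing = zeroʳ (w f2) (w f3) , zeroˡ (u f1) (u f0)
    where u w : Column
          u = proj₁ (D-flag {p} (just zero))
          w = proj₂ (D-flag {p} (just zero))
  D-minors-vanish (just (suc l)) nothing = zeroʳ (w f2) (w f3) , zeroˡ (u f1) (u f0)
    where u w : Column
          u = proj₁ (D-flag {p} (just (suc l)))
          w = proj₂ (D-flag {p} (just (suc l)))
  D-minors-vanish nothing nothing = zeroʳ (w f2) (w f3) , zeroˡ (u f1) (u f0)
    where u w : Column
          u = proj₁ (D-flag {p} nothing)
          w = proj₂ (D-flag {p} nothing)

  unit≢zero : ∀ {x z} k → p∤ x → p∣ z → x ≡ₚ k * z → ⊥
  unit≢zero {x} {z} k p∤x p∣z e = p∤x (∣-by (cert x k z) (p∣difference e ⊞ k ⊠ p∣z))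
    where cert : ∀ x k z → x ≡ (x - k * z) + k * z
          cert = solve-∀

  zero≢unit : ∀ {x z} k → p∣ x → p∤ k → p∤ z → x ≡ₚ k * z → ⊥
  zero≢unit {x} {z} k p∣x p∤k p∤z e = p∤-* p∤k p∤z (∣-by (cert x k z) (p∣x ⊞ -1ℤ ⊠ p∣difference e))
    where cert : ∀ x k z → k * z ≡ x + -1ℤ * (x - k * z)
          cert = solve-∀

  flag-injective : ∀ (i j : Idx p) → ValidIdx i → ValidIdx j → SameFlag (flag i) (flag j) → i ≡ j
  flag-injective (A n q r y) (A n′ q′ r′ y′) _ _ R = A-injective n q r y n′ q′ r′ y′ R
  flag-injective (B n q r y) (B n′ q′ r′ y′) _ _ R = B-injective n q r y n′ q′ r′ y′ R
  flag-injective (D l y) (D l′ y′) _ _ R = D-injective l y l′ y′ R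
  flag-injective (A n q r y) (B n′ q′ r′ y′) _ valid R = ⊥-elim (unit≢zero (ac R)
    (A-bottom-unit n q r y) (B-bottom-vanishes n′ q′ r′ y′ valid) (SameFlag-minor f2 f3 R))
  flag-injective (A n q r y) (D l′ y′) _ _ R = ⊥-elim (unit≢zero (ac R)
    (A-bottom-unit n q r y) (∣-by (proj₁ (D-minors-vanish l′ y′)) ∣0) (SameFlag-minor f2 f3 R))
  flag-injective (B n q r y) (A n′ q′ r′ y′) valid _ R = ⊥-elim (zero≢unit (ac R)
    (B-bottom-vanishes n q r y valid) (p∤ac R) (A-bottom-unit n′ q′ r′ y′) (SameFlag-minor f2 f3 R))
  flag-injective (D l y) (A n′ q′ r′ y′) _ _ R = ⊥-elim (zero≢unit (ac R)
    (∣-by (proj₁ (D-minors-vanish l y)) ∣0) (p∤ac R) (A-bottom-unit n′ q′ r′ y′) (SameFlag-minor f2 f3 R))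
  flag-injective (B n q r y) (D l′ y′) _ _ R = ⊥-elim (unit≢zero (ac R)
    (B-top-unit n q r y) (∣-by (proj₂ (D-minors-vanish l′ y′)) ∣0) (SameFlag-minor f0 f1 R))
  flag-injective (D l y) (B n′ q′ r′ y′) _ _ R = ⊥-elim (zero≢unit (ac R)
    (∣-by (proj₂ (D-minors-vanish l y)) ∣0) (p∤ac R) (B-top-unit n′ q′ r′ y′) (SameFlag-minor f0 f1 R))

-- Existence

module Existence (p : ℕ) (p-prime : Prime p) where
  open ResidueField p p-prime
  open Cosets p p-prime

  record Refines (G F : Flag) : Set where
    constructor mkRefines
    field
      a b c : ℤ
      column₀ : ∀ r → proj₁ G r ≡ₚ a * proj₁ F r + b * proj₂ F r
      column₁ : ∀ r → proj₂ G r ≡ₚ c * proj₂ F r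

  Refines-respʳ : ∀ {G F F′} → F′ ≗ᶠ F → Refines G F → Refines G F′
  Refines-respʳ e (mkRefines a b c column₀ column₁) = mkRefines a b c
    (λ r → ≡ₚ-trans (column₀ r) (≡⇒≡ₚ (sym (cong₂ (λ u v → a * u + b * v) (proj₁ (e r)) (proj₂ (e r))))))
    (λ r → ≡ₚ-trans (column₁ r) (≡⇒≡ₚ (sym (cong (c *_) (proj₂ (e r))))))

  record Spans (G F : Flag) : Set where
    constructor mkSpans
    field
      x₀ x₁ z₀ z₁ : ℤ
      column₀ : ∀ r → proj₁ G r ≡ₚ x₀ * proj₁ F r + x₁ * proj₂ F r
      column₁ : ∀ r → proj₂ G r ≡ₚ z₀ * proj₁ F r + z₁ * proj₂ F r

  -- Z_y for y ≡ z₀/z₁ (or y = ∞ when p ∣ z₁) moves the second column of F onto the line of G₁.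
  Z-step : ∀ {G F} → Spans G F → Σ (V p) λ y → Refines G (Z-action y F)
  Z-step {G} {F₀ , F₁} (mkSpans x₀ x₁ z₀ z₁ G₀≡ G₁≡) with p∣? z₁
  ... | inj₁ p∣z₁ = nothing , mkRefines x₁ x₀ z₀
        (λ r → ≡ₚ-trans (G₀≡ r) (≡⇒≡ₚ (ℤP.+-comm (x₀ * F₀ r) (x₁ * F₁ r))))
        (λ r → ≡ₚ-trans (G₁≡ r) (mkₚ (∣-by (cert z₀ z₁ (F₀ r) (F₁ r)) (F₁ r ⊠ p∣z₁))))
    where cert : ∀ z₀ z₁ u v → (z₀ * u + z₁ * v) - z₀ * u ≡ v * z₁
          cert = solve-∀
  ... | inj₂ p∤z₁ = just y , mkRefines (x₀ - x₁ * Y) x₁ z₁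
        (λ r → ≡ₚ-trans (G₀≡ r) (≡⇒≡ₚ (regroup x₀ x₁ (F₀ r) (F₁ r) Y)))
        (λ r → ≡ₚ-trans (G₁≡ r) (mkₚ (∣-by (cert z₀ z₁ (F₀ r) (F₁ r) Y w)
                                            ((- (F₀ r * z₁)) ⊠ residue-≡ (z₀ * w) ⊞ (- (F₀ r * z₀)) ⊠ z₁w≡1))))
    where
    w = proj₁ (inverse z₁ p∤z₁)
    z₁w≡1 = proj₂ (inverse z₁ p∤z₁)
    y = residue (z₀ * w)
    Y = + toℕ y
    regroup : ∀ x₀ x₁ u v Y → x₀ * u + x₁ * v ≡ (x₀ - x₁ * Y) * u + x₁ * (Y * u + v)
    regroup = solve-∀
    cert : ∀ z₀ z₁ u v Y w → (z₀ * u + z₁ * v) - z₁ * (Y * u + v) ≡ (- (u * z₁)) * (Y - z₀ * w) + (- (u * z₀)) * (z₁ * w - 1ℤ)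
    cert = solve-∀

  FlagRepresentative : Flag → Set
  FlagRepresentative G = Σ (Idx p) λ i → ValidIdx i × Refines G (flag i)

  module Classification (g : Mat) (μ : ℤ) (p∤μ : p∤ μ)
    (ω-rel : ∀ i j → ω (column g i) (column g j) ≡ₚ μ * Jm i j 1) where

    g₀₀ g₀₁ g₀₂ g₀₃ g₁₀ g₁₁ g₁₂ g₁₃ g₂₀ g₂₁ g₂₂ g₂₃ g₃₀ g₃₁ g₃₂ g₃₃ : ℤ
    g₀₀ = g f0 f0 1 ; g₀₁ = g f0 f1 1 ; g₀₂ = g f0 f2 1 ; g₀₃ = g f0 f3 1
    g₁₀ = g f1 f0 1 ; g₁₁ = g f1 f1 1 ; g₁₂ = g f1 f2 1 ; g₁₃ = g f1 f3 1
    g₂₀ = g f2 f0 1 ; g₂₁ = g f2 f1 1 ; g₂₂ = g f2 f2 1 ; g₂₃ = g f2 f3 1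
    g₃₀ = g f3 f0 1 ; g₃₁ = g f3 f1 1 ; g₃₂ = g f3 f2 1 ; g₃₃ = g f3 f3 1

    ω₀₁ : p∣ ((g₀₀ * g₂₁ + g₁₀ * g₃₁ - g₂₀ * g₀₁ - g₃₀ * g₁₁) - μ * 0ℤ)
    ω₀₁ = p∣difference (ω-rel f0 f1)

    G : Flag
    G = flagOf g

    -- Pairing a G₀ + b G₁ with G₂ and G₃ under ω gives a μ ≡ 0 and b μ ≡ 0.
    independent : ∀ a b → p∣ (a * g₀₀ + b * g₀₁) → p∣ (a * g₁₀ + b * g₁₁) → p∣ (a * g₂₀ + b * g₂₁) →
      p∣ (a * g₃₀ + b * g₃₁) → p∣ a × p∣ b
    independent a b d₀ d₁ d₂ d₃ =
      p∣-cancelˡ μ a p∤μ (∣-by (ℤP.*-comm μ a) (∣-by (cert₂ a b g₀₀ g₀₁ g₁₀ g₁₁ g₂₀ g₂₁ g₃₀ g₃₁ g₀₂ g₁₂ g₂₂ g₃₂ μ)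
        (g₂₂ ⊠ d₀ ⊞ g₃₂ ⊠ d₁ ⊞ (- g₀₂) ⊠ d₂ ⊞ (- g₁₂) ⊠ d₃ ⊞ (- a) ⊠ p∣difference (ω-rel f0 f2) ⊞ (- b) ⊠ p∣difference (ω-rel f1 f2)))) ,
      p∣-cancelˡ μ b p∤μ (∣-by (ℤP.*-comm μ b) (∣-by (cert₃ a b g₀₀ g₀₁ g₁₀ g₁₁ g₂₀ g₂₁ g₃₀ g₃₁ g₀₃ g₁₃ g₂₃ g₃₃ μ)
        (g₂₃ ⊠ d₀ ⊞ g₃₃ ⊠ d₁ ⊞ (- g₀₃) ⊠ d₂ ⊞ (- g₁₃) ⊠ d₃ ⊞ (- a) ⊠ p∣difference (ω-rel f0 f3) ⊞ (- b) ⊠ p∣difference (ω-rel f1 f3))))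
      where
      cert₂ : ∀ a b g00 g01 g10 g11 g20 g21 g30 g31 g02 g12 g22 g32 μ → a * μ ≡
        g22 * (a * g00 + b * g01) + g32 * (a * g10 + b * g11) + (- g02) * (a * g20 + b * g21) + (- g12) * (a * g30 + b * g31)
        + (- a) * ((g00 * g22 + g10 * g32 - g20 * g02 - g30 * g12) - μ * 1ℤ) + (- b) * ((g01 * g22 + g11 * g32 - g21 * g02 - g31 * g12) - μ * 0ℤ)
      cert₂ = solve-∀
      cert₃ : ∀ a b g00 g01 g10 g11 g20 g21 g30 g31 g03 g13 g23 g33 μ → b * μ ≡
        g23 * (a * g00 + b * g01) + g33 * (a * g10 + b * g11) + (- g03) * (a * g20 + b * g21) + (- g13) * (a * g30 + b * g31)
        + (- a) * ((g00 * g23 + g10 * g33 - g20 * g03 - g30 * g13) - μ * 0ℤ) + (- b) * ((g01 * g23 + g11 * g33 - g21 * g03 - g31 * g13) - μ * 1ℤ)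
      cert₃ = solve-∀

    bottom-minor top-minor : ℤ
    bottom-minor = g₂₀ * g₃₁ - g₃₀ * g₂₁
    top-minor = g₀₀ * g₁₁ - g₁₀ * g₀₁

    -- When p ∤ bottom-minor, the top half of each column of G is X times its bottom half, for
    -- X = [[n q] [q r]] given by Cramer's rule; X is symmetric because ω(G₀, G₁) ≡ 0.
    case-A : p∤ bottom-minor → FlagRepresentative G
    case-A p∤Δ = let (y , R) = Z-step spans in A n q r y , tt , R
      where
      d = proj₁ (inverse bottom-minor p∤Δ)
      Δd≡1 = proj₂ (inverse bottom-minor p∤Δ)
      n q r : Fin p
      n = residue (d * (g₀₀ * g₃₁ - g₀₁ * g₃₀))
      q = residue (d * (g₀₁ * g₂₀ - g₀₀ * g₂₁))
      r = residue (d * (g₁₁ * g₂₀ - g₁₀ * g₂₁))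
      N Q R : ℤ
      N = + toℕ n
      Q = + toℕ q
      R = + toℕ r
      n≡ = residue-≡ (d * (g₀₀ * g₃₁ - g₀₁ * g₃₀))
      q≡ = residue-≡ (d * (g₀₁ * g₂₀ - g₀₀ * g₂₁))
      r≡ = residue-≡ (d * (g₁₁ * g₂₀ - g₁₀ * g₂₁))
      q≡′ : p∣ (Q - d * (g₁₀ * g₃₁ - g₁₁ * g₃₀))
      q≡′ = ∣-by (cert Q d g₀₀ g₁₀ g₂₀ g₃₀ g₀₁ g₁₁ g₂₁ g₃₁ μ) (q≡ ⊞ (- d) ⊠ ω₀₁)
        where cert : ∀ Q d g00 g10 g20 g30 g01 g11 g21 g31 μ → Q - d * (g10 * g31 - g11 * g30) ≡
                (Q - d * (g01 * g20 - g00 * g21)) + (- d) * ((g00 * g21 + g10 * g31 - g20 * g01 - g30 * g11) - μ * 0ℤ)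
              cert = solve-∀
      top₀ : ∀ g00 g01 g20 g21 g30 g31 N Q d → g00 - ((- g20) * (- N) + (- g30) * (- Q)) ≡
        (- g20) * (N - d * (g00 * g31 - g01 * g30)) + (- g30) * (Q - d * (g01 * g20 - g00 * g21)) + (- g00) * ((g20 * g31 - g30 * g21) * d - 1ℤ)
      top₀ = solve-∀
      top₁ : ∀ g10 g11 g20 g21 g30 g31 Q R d → g10 - ((- g20) * (- Q) + (- g30) * (- R)) ≡
        (- g20) * (Q - d * (g10 * g31 - g11 * g30)) + (- g30) * (R - d * (g11 * g20 - g10 * g21)) + (- g10) * ((g20 * g31 - g30 * g21) * d - 1ℤ)
      top₁ = solve-∀
      top₀′ : ∀ g00 g01 g20 g21 g30 g31 N Q d → g01 - ((- g21) * (- N) + (- g31) * (- Q)) ≡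
        (- g21) * (N - d * (g00 * g31 - g01 * g30)) + (- g31) * (Q - d * (g01 * g20 - g00 * g21)) + (- g01) * ((g20 * g31 - g30 * g21) * d - 1ℤ)
      top₀′ = solve-∀
      top₁′ : ∀ g10 g11 g20 g21 g30 g31 Q R d → g11 - ((- g21) * (- Q) + (- g31) * (- R)) ≡
        (- g21) * (Q - d * (g10 * g31 - g11 * g30)) + (- g31) * (R - d * (g11 * g20 - g10 * g21)) + (- g11) * ((g20 * g31 - g30 * g21) * d - 1ℤ)
      top₁′ = solve-∀
      bottom : ∀ x y → x ≡ (- x) * -1ℤ + (- y) * 0ℤ
      bottom = solve-∀
      bottom′ : ∀ x y → y ≡ (- x) * 0ℤ + (- y) * -1ℤ
      bottom′ = solve-∀
      spans : Spans G (A-flag n q r)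
      spans = mkSpans (- g₂₀) (- g₃₀) (- g₂₁) (- g₃₁)
        (λ { zero → mkₚ (∣-by (top₀ g₀₀ g₀₁ g₂₀ g₂₁ g₃₀ g₃₁ N Q d) ((- g₂₀) ⊠ n≡ ⊞ (- g₃₀) ⊠ q≡ ⊞ (- g₀₀) ⊠ Δd≡1))
           ; (suc zero) → mkₚ (∣-by (top₁ g₁₀ g₁₁ g₂₀ g₂₁ g₃₀ g₃₁ Q R d) ((- g₂₀) ⊠ q≡′ ⊞ (- g₃₀) ⊠ r≡ ⊞ (- g₁₀) ⊠ Δd≡1))
           ; (suc (suc zero)) → ≡⇒≡ₚ (bottom g₂₀ g₃₀)
           ; (suc (suc (suc zero))) → ≡⇒≡ₚ (bottom′ g₂₀ g₃₀) })
        (λ { zero → mkₚ (∣-by (top₀′ g₀₀ g₀₁ g₂₀ g₂₁ g₃₀ g₃₁ N Q d) ((- g₂₁) ⊠ n≡ ⊞ (- g₃₁) ⊠ q≡ ⊞ (- g₀₁) ⊠ Δd≡1))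
           ; (suc zero) → mkₚ (∣-by (top₁′ g₁₀ g₁₁ g₂₀ g₂₁ g₃₀ g₃₁ Q R d) ((- g₂₁) ⊠ q≡′ ⊞ (- g₃₁) ⊠ r≡ ⊞ (- g₁₁) ⊠ Δd≡1))
           ; (suc (suc zero)) → ≡⇒≡ₚ (bottom g₂₁ g₃₁)
           ; (suc (suc (suc zero))) → ≡⇒≡ₚ (bottom′ g₂₁ g₃₁) })

    -- When p ∣ bottom-minor but p ∤ top-minor the roles of the two halves are exchanged;
    -- the vanishing bottom minor becomes the condition q² − nr ≡ 0.
    case-B : p∣ bottom-minor → p∤ top-minor → FlagRepresentative G
    case-B p∣Δ p∤Δ′ = let (y , R) = Z-step spans in B n q r y , ∣⇒∣ᵤ valid , R
      where
      e = proj₁ (inverse top-minor p∤Δ′)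
      Δ′e≡1 = proj₂ (inverse top-minor p∤Δ′)
      Yn Yq Yq′ Yr : ℤ
      Yn = - (g₂₀ * g₁₁ - g₂₁ * g₁₀)
      Yq = - (g₂₁ * g₀₀ - g₂₀ * g₀₁)
      Yq′ = - (g₃₀ * g₁₁ - g₃₁ * g₁₀)
      Yr = - (g₃₁ * g₀₀ - g₃₀ * g₀₁)
      n q r : Fin p
      n = residue (e * Yn)
      q = residue (e * Yq)
      r = residue (e * Yr)
      N Q R : ℤ
      N = + toℕ n
      Q = + toℕ q
      R = + toℕ r
      n≡ = residue-≡ (e * Yn)
      q≡ = residue-≡ (e * Yq)
      r≡ = residue-≡ (e * Yr)
      q≡′ : p∣ (Q - e * Yq′)
      q≡′ = ∣-by (cert Q e g₀₀ g₁₀ g₂₀ g₃₀ g₀₁ g₁₁ g₂₁ g₃₁ μ) (q≡ ⊞ (- e) ⊠ ω₀₁)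
        where cert : ∀ Q e g00 g10 g20 g30 g01 g11 g21 g31 μ → Q - e * (- (g30 * g11 - g31 * g10)) ≡
                (Q - e * (- (g21 * g00 - g20 * g01))) + (- e) * ((g00 * g21 + g10 * g31 - g20 * g01 - g30 * g11) - μ * 0ℤ)
              cert = solve-∀
      valid : p∣ (Q * Q - N * R)
      valid = ∣-by (cert Q N R e Yq Yq′ Yn Yr) (Q ⊠ q≡′ ⊞ (e * Yq′) ⊠ q≡ ⊞ (- N) ⊠ r≡ ⊞ (- (e * Yr)) ⊠ n≡ ⊞ (e * e) ⊠ minors)
        where
        cert : ∀ Q N R e a b c d → Q * Q - N * R ≡
          Q * (Q - e * b) + (e * b) * (Q - e * a) + (- N) * (R - e * d) + (- (e * d)) * (N - e * c) + (e * e) * (a * b - c * d)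
        cert = solve-∀
        minors : p∣ (Yq * Yq′ - Yn * Yr)
        minors = ∣-by (cert′ g₀₀ g₀₁ g₁₀ g₁₁ g₂₀ g₂₁ g₃₀ g₃₁) ((- top-minor) ⊠ p∣Δ)
          where cert′ : ∀ g00 g01 g10 g11 g20 g21 g30 g31 →
                  (- (g21 * g00 - g20 * g01)) * (- (g30 * g11 - g31 * g10)) - (- (g20 * g11 - g21 * g10)) * (- (g31 * g00 - g30 * g01))
                  ≡ (- (g00 * g11 - g10 * g01)) * (g20 * g31 - g30 * g21)
                cert′ = solve-∀
      bottom₂ : ∀ g00 g01 g10 g11 g20 g21 N Q e → g20 - ((- g00) * N + (- g10) * Q) ≡
        g00 * (N - e * (- (g20 * g11 - g21 * g10))) + g10 * (Q - e * (- (g21 * g00 - g20 * g01))) + (- g20) * ((g00 * g11 - g10 * g01) * e - 1ℤ)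
      bottom₂ = solve-∀
      bottom₃ : ∀ g00 g01 g10 g11 g30 g31 Q R e → g30 - ((- g00) * Q + (- g10) * R) ≡
        g00 * (Q - e * (- (g30 * g11 - g31 * g10))) + g10 * (R - e * (- (g31 * g00 - g30 * g01))) + (- g30) * ((g00 * g11 - g10 * g01) * e - 1ℤ)
      bottom₃ = solve-∀
      bottom₂′ : ∀ g00 g01 g10 g11 g20 g21 N Q e → g21 - ((- g01) * N + (- g11) * Q) ≡
        g01 * (N - e * (- (g20 * g11 - g21 * g10))) + g11 * (Q - e * (- (g21 * g00 - g20 * g01))) + (- g21) * ((g00 * g11 - g10 * g01) * e - 1ℤ)
      bottom₂′ = solve-∀
      bottom₃′ : ∀ g00 g01 g10 g11 g30 g31 Q R e → g31 - ((- g01) * Q + (- g11) * R) ≡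
        g01 * (Q - e * (- (g30 * g11 - g31 * g10))) + g11 * (R - e * (- (g31 * g00 - g30 * g01))) + (- g31) * ((g00 * g11 - g10 * g01) * e - 1ℤ)
      bottom₃′ = solve-∀
      top : ∀ x y → x ≡ (- x) * -1ℤ + (- y) * 0ℤ
      top = solve-∀
      top′ : ∀ x y → y ≡ (- x) * 0ℤ + (- y) * -1ℤ
      top′ = solve-∀
      spans : Spans G (B-flag n q r)
      spans = mkSpans (- g₀₀) (- g₁₀) (- g₀₁) (- g₁₁)
        (λ { zero → ≡⇒≡ₚ (top g₀₀ g₁₀)
           ; (suc zero) → ≡⇒≡ₚ (top′ g₀₀ g₁₀)
           ; (suc (suc zero)) → mkₚ (∣-by (bottom₂ g₀₀ g₀₁ g₁₀ g₁₁ g₂₀ g₂₁ N Q e) (g₀₀ ⊠ n≡ ⊞ g₁₀ ⊠ q≡ ⊞ (- g₂₀) ⊠ Δ′e≡1))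
           ; (suc (suc (suc zero))) → mkₚ (∣-by (bottom₃ g₀₀ g₀₁ g₁₀ g₁₁ g₃₀ g₃₁ Q R e) (g₀₀ ⊠ q≡′ ⊞ g₁₀ ⊠ r≡ ⊞ (- g₃₀) ⊠ Δ′e≡1)) })
        (λ { zero → ≡⇒≡ₚ (top g₀₁ g₁₁)
           ; (suc zero) → ≡⇒≡ₚ (top′ g₀₁ g₁₁)
           ; (suc (suc zero)) → mkₚ (∣-by (bottom₂′ g₀₀ g₀₁ g₁₀ g₁₁ g₂₀ g₂₁ N Q e) (g₀₁ ⊠ n≡ ⊞ g₁₁ ⊠ q≡ ⊞ (- g₂₁) ⊠ Δ′e≡1))
           ; (suc (suc (suc zero))) → mkₚ (∣-by (bottom₃′ g₀₀ g₀₁ g₁₀ g₁₁ g₃₀ g₃₁ Q R e) (g₀₁ ⊠ q≡′ ⊞ g₁₁ ⊠ r≡ ⊞ (- g₃₁) ⊠ Δ′e≡1)) })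

    -- When both minors vanish, ⟨G₀, G₁⟩ contains a vector t = (t₀, t₁, 0, 0) and a vector
    -- w = (0, 0, w₂, w₃); the point (t₀ : t₁) of ℙ¹(𝔽ₚ) determines λ.
    module Degenerate (t₀ t₁ w₂ w₃ : ℤ) (t≢0 : ¬ (p∣ t₀ × p∣ t₁)) (w≢0 : ¬ (p∣ w₂ × p∣ w₃))
      (ωtG₀ : p∣ (t₀ * g₂₀ + t₁ * g₃₀)) (ωtG₁ : p∣ (t₀ * g₂₁ + t₁ * g₃₁))
      (ωG₀w : p∣ (g₀₀ * w₂ + g₁₀ * w₃)) (ωG₁w : p∣ (g₀₁ * w₂ + g₁₁ * w₃)) (ωtw : p∣ (t₀ * w₂ + t₁ * w₃)) where

      -- ω(t, c) ≡ 0 and ω(c, w) ≡ 0.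
      Orthogonal : Column → Set
      Orthogonal c = p∣ (t₀ * c f2 + t₁ * c f3) × p∣ (c f0 * w₂ + c f1 * w₃)

      fromOrthogonal : ∀ (l : V p) (x₀ x₁ : Column → ℤ) →
        (∀ c → Orthogonal c → ∀ r → c r ≡ₚ x₀ c * proj₁ (D-flag l) r + x₁ c * proj₂ (D-flag l) r) →
        FlagRepresentative G
      fromOrthogonal l x₀ x₁ in-span =
        let (y , R) = Z-step (mkSpans (x₀ G₀) (x₁ G₀) (x₀ G₁) (x₁ G₁) (in-span G₀ (ωtG₀ , ωG₀w)) (in-span G₁ (ωtG₁ , ωG₁w)))
        in D l y , tt , R
        where
        G₀ G₁ : Column
        G₀ = column g f0
        G₁ = column g f1

      cancel₁ : ∀ t₀ t₁ c₂ c₃ → t₀ * c₂ ≡ (t₀ * c₂ + t₁ * c₃) + (- c₃) * t₁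
      cancel₁ = solve-∀
      cancel₂ : ∀ c₀ c₁ w₂ w₃ → w₃ * c₁ ≡ (c₀ * w₂ + c₁ * w₃) + (- c₀) * w₂
      cancel₂ = solve-∀

      λ≡∞ : p∣ t₁ → FlagRepresentative G
      λ≡∞ p∣t₁ = fromOrthogonal nothing (λ c → - c f0) (λ c → c f3) in-span
        where
        p∤t₀ : p∤ t₀
        p∤t₀ d = t≢0 (d , p∣t₁)
        p∣w₂ : p∣ w₂
        p∣w₂ = p∣-cancelˡ t₀ w₂ p∤t₀ (∣-by (cancel₁ t₀ t₁ w₂ w₃) (ωtw ⊞ (- w₃) ⊠ p∣t₁))
        p∤w₃ : p∤ w₃
        p∤w₃ d = w≢0 (p∣w₂ , d)
        in-span : ∀ c → Orthogonal c → ∀ r → c r ≡ₚ (- c f0) * proj₁ (D-flag {p} nothing) r + c f3 * proj₂ (D-flag {p} nothing) r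
        in-span c (ωtc , ωcw) = λ
          { zero → ≡⇒≡ₚ (row₀ (c f0) (c f3))
          ; (suc zero) → mkₚ (∣-by (vanish (c f0) (c f3) (c f1))
              (p∣-cancelˡ w₃ (c f1) p∤w₃ (∣-by (cancel₂ (c f0) (c f1) w₂ w₃) (ωcw ⊞ (- c f0) ⊠ p∣w₂))))
          ; (suc (suc zero)) → mkₚ (∣-by (vanish (c f0) (c f3) (c f2))
              (p∣-cancelˡ t₀ (c f2) p∤t₀ (∣-by (cancel₁ t₀ t₁ (c f2) (c f3)) (ωtc ⊞ (- c f3) ⊠ p∣t₁))))
          ; (suc (suc (suc zero))) → ≡⇒≡ₚ (row₃ (c f0) (c f3)) }
          where
          row₀ : ∀ c₀ c₃ → c₀ ≡ (- c₀) * -1ℤ + c₃ * 0ℤ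
          row₀ = solve-∀
          row₃ : ∀ c₀ c₃ → c₃ ≡ (- c₀) * 0ℤ + c₃ * 1ℤ
          row₃ = solve-∀
          vanish : ∀ c₀ c₃ x → x - ((- c₀) * 0ℤ + c₃ * 0ℤ) ≡ x
          vanish = solve-∀

      cancel₃ : ∀ t₀ t₁ c₂ c₃ → t₁ * c₃ ≡ (t₀ * c₂ + t₁ * c₃) + (- c₂) * t₀
      cancel₃ = solve-∀

      -- λ ≡ −t₀/t₁, where w is an inverse of t₁.
      λ-finite : ∀ w → p∣ (t₁ * w - 1ℤ) → p∤ t₁ → (x : Fin p) → p∣ (+ toℕ x - (- t₀) * w) → FlagRepresentative G
      λ-finite w t₁w≡1 p∤t₁ zero x≡ = fromOrthogonal (just zero) (λ c → - c f1) (λ c → c f2) in-span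
        where
        p∤w : p∤ w
        p∤w d = p∤1 (∣-by (cert t₁ w) (t₁ ⊠ d ⊞ -1ℤ ⊠ t₁w≡1))
          where cert : ∀ t₁ w → 1ℤ ≡ t₁ * w + -1ℤ * (t₁ * w - 1ℤ)
                cert = solve-∀
        p∣t₀ : p∣ t₀
        p∣t₀ = p∣-cancelˡ w t₀ p∤w (∣-by (cert t₀ w) x≡)
          where cert : ∀ t₀ w → w * t₀ ≡ + 0 - (- t₀) * w
                cert = solve-∀
        p∣w₃ : p∣ w₃
        p∣w₃ = p∣-cancelˡ t₁ w₃ p∤t₁ (∣-by (cancel₃ t₀ t₁ w₂ w₃) (ωtw ⊞ (- w₂) ⊠ p∣t₀))
        p∤w₂ : p∤ w₂
        p∤w₂ d = w≢0 (d , p∣w₃)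
        in-span : ∀ c → Orthogonal c → ∀ r → c r ≡ₚ (- c f1) * proj₁ (D-flag {p} (just zero)) r + c f2 * proj₂ (D-flag {p} (just zero)) r
        in-span c (ωtc , ωcw) = λ
          { zero → mkₚ (∣-by (vanish (c f1) (c f2) (c f0))
              (p∣-cancelˡ w₂ (c f0) p∤w₂ (∣-by (cert (c f0) (c f1) w₂ w₃) (ωcw ⊞ (- c f1) ⊠ p∣w₃))))
          ; (suc zero) → ≡⇒≡ₚ (row₁ (c f1) (c f2))
          ; (suc (suc zero)) → ≡⇒≡ₚ (row₂ (c f1) (c f2))
          ; (suc (suc (suc zero))) → mkₚ (∣-by (vanish (c f1) (c f2) (c f3))
              (p∣-cancelˡ t₁ (c f3) p∤t₁ (∣-by (cancel₃ t₀ t₁ (c f2) (c f3)) (ωtc ⊞ (- c f2) ⊠ p∣t₀)))) }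
          where
          row₁ : ∀ c₁ c₂ → c₁ ≡ (- c₁) * -1ℤ + c₂ * 0ℤ
          row₁ = solve-∀
          row₂ : ∀ c₁ c₂ → c₂ ≡ (- c₁) * 0ℤ + c₂ * 1ℤ
          row₂ = solve-∀
          vanish : ∀ c₁ c₂ x → x - ((- c₁) * 0ℤ + c₂ * 0ℤ) ≡ x
          vanish = solve-∀
          cert : ∀ c₀ c₁ w₂ w₃ → w₂ * c₀ ≡ (c₀ * w₂ + c₁ * w₃) + (- c₁) * w₃
          cert = solve-∀
      λ-finite w t₁w≡1 p∤t₁ (suc l) x≡ = fromOrthogonal (just (suc l)) (λ c → c f1) (λ c → c f2) in-span
        where
        L = + suc (toℕ l)
        t₁L+t₀≡0 : p∣ (t₁ * L + t₀)
        t₁L+t₀≡0 = ∣-by (cert t₀ t₁ L w) (t₁ ⊠ x≡ ⊞ (- t₀) ⊠ t₁w≡1)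
          where cert : ∀ t₀ t₁ L w → t₁ * L + t₀ ≡ t₁ * (L - (- t₀) * w) + (- t₀) * (t₁ * w - 1ℤ)
                cert = solve-∀
        bottom : ∀ c₂ c₃ → p∣ (t₀ * c₂ + t₁ * c₃) → p∣ (c₃ - L * c₂)
        bottom c₂ c₃ ωtc = p∣-cancelˡ t₁ (c₃ - L * c₂) p∤t₁ (∣-by (cert t₀ t₁ c₂ c₃ L) (ωtc ⊞ (- c₂) ⊠ t₁L+t₀≡0))
          where cert : ∀ t₀ t₁ c₂ c₃ L → t₁ * (c₃ - L * c₂) ≡ (t₀ * c₂ + t₁ * c₃) + (- c₂) * (t₁ * L + t₀)
                cert = solve-∀
        w₃≡Lw₂ : p∣ (w₃ - L * w₂)
        w₃≡Lw₂ = bottom w₂ w₃ ωtw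
        p∤w₂ : p∤ w₂
        p∤w₂ d = w≢0 (d , ∣-by (cert w₂ w₃ L) (w₃≡Lw₂ ⊞ L ⊠ d))
          where cert : ∀ w₂ w₃ L → w₃ ≡ (w₃ - L * w₂) + L * w₂
                cert = solve-∀
        in-span : ∀ c → Orthogonal c → ∀ r → c r ≡ₚ c f1 * proj₁ (D-flag {p} (just (suc l))) r + c f2 * proj₂ (D-flag {p} (just (suc l))) r
        in-span c (ωtc , ωcw) = λ
          { zero → mkₚ (∣-by (row₀ (c f0) (c f1) (c f2) L)
              (p∣-cancelˡ w₂ (c f0 + L * c f1) p∤w₂ (∣-by (cert (c f0) (c f1) w₂ w₃ L) (ωcw ⊞ (- c f1) ⊠ w₃≡Lw₂))))
          ; (suc zero) → ≡⇒≡ₚ (row₁ (c f1) (c f2))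
          ; (suc (suc zero)) → ≡⇒≡ₚ (row₂ (c f1) (c f2))
          ; (suc (suc (suc zero))) → mkₚ (∣-by (row₃ (c f1) (c f2) (c f3) L) (bottom (c f2) (c f3) ωtc)) }
          where
          row₀ : ∀ c₀ c₁ c₂ L → c₀ - (c₁ * (- L) + c₂ * 0ℤ) ≡ c₀ + L * c₁
          row₀ = solve-∀
          row₁ : ∀ c₁ c₂ → c₁ ≡ c₁ * 1ℤ + c₂ * 0ℤ
          row₁ = solve-∀
          row₂ : ∀ c₁ c₂ → c₂ ≡ c₁ * 0ℤ + c₂ * 1ℤ
          row₂ = solve-∀
          row₃ : ∀ c₁ c₂ c₃ L → c₃ - (c₁ * 0ℤ + c₂ * L) ≡ c₃ - L * c₂
          row₃ = solve-∀
          cert : ∀ c₀ c₁ w₂ w₃ L → w₂ * (c₀ + L * c₁) ≡ (c₀ * w₂ + c₁ * w₃) + (- c₁) * (w₃ - L * w₂)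
          cert = solve-∀

      degenerate : FlagRepresentative G
      degenerate with p∣? t₁
      ... | inj₁ p∣t₁ = λ≡∞ p∣t₁
      ... | inj₂ p∤t₁ = let (w , t₁w≡1) = inverse t₁ p∤t₁ in
                        λ-finite w t₁w≡1 p∤t₁ (residue ((- t₀) * w)) (residue-≡ ((- t₀) * w))


    case-D : p∣ bottom-minor → p∣ top-minor → FlagRepresentative G
    case-D p∣Δ p∣Δ′ = Degenerate.degenerate t₀ t₁ w₂ w₃ t≢0 w≢0 ωtG₀ ωtG₁ ωG₀w ωG₁w ωtw
      where
      kt = singular⇒Kernel g₂₀ g₂₁ g₃₀ g₃₁ p∣Δ
      kw = singular⇒Kernel g₀₀ g₀₁ g₁₀ g₁₁ p∣Δ′
      module Kt = Kernel kt
      module Kw = Kernel kw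
      t₀ t₁ w₂ w₃ : ℤ
      t₀ = Kt.α * g₀₀ + Kt.β * g₀₁
      t₁ = Kt.α * g₁₀ + Kt.β * g₁₁
      w₂ = Kw.α * g₂₀ + Kw.β * g₂₁
      w₃ = Kw.α * g₃₀ + Kw.β * g₃₁
      t≢0 : ¬ (p∣ t₀ × p∣ t₁)
      t≢0 (d₀ , d₁) = Kt.nonzero (independent Kt.α Kt.β d₀ d₁ Kt.first Kt.second)
      w≢0 : ¬ (p∣ w₂ × p∣ w₃)
      w≢0 (d₂ , d₃) = Kw.nonzero (independent Kw.α Kw.β Kw.first Kw.second d₂ d₃)
      ωtG₀ : p∣ (t₀ * g₂₀ + t₁ * g₃₀)
      ωtG₀ = ∣-by (cert Kt.α Kt.β g₀₀ g₁₀ g₂₀ g₃₀ g₀₁ g₁₁ g₂₁ g₃₁ μ) ((- Kt.β) ⊠ ω₀₁ ⊞ g₀₀ ⊠ Kt.first ⊞ g₁₀ ⊠ Kt.second)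
        where cert : ∀ a b g00 g10 g20 g30 g01 g11 g21 g31 μ → (a * g00 + b * g01) * g20 + (a * g10 + b * g11) * g30 ≡
                (- b) * ((g00 * g21 + g10 * g31 - g20 * g01 - g30 * g11) - μ * 0ℤ) + g00 * (a * g20 + b * g21) + g10 * (a * g30 + b * g31)
              cert = solve-∀
      ωtG₁ : p∣ (t₀ * g₂₁ + t₁ * g₃₁)
      ωtG₁ = ∣-by (cert Kt.α Kt.β g₀₀ g₁₀ g₂₀ g₃₀ g₀₁ g₁₁ g₂₁ g₃₁ μ) (Kt.α ⊠ ω₀₁ ⊞ g₀₁ ⊠ Kt.first ⊞ g₁₁ ⊠ Kt.second)
        where cert : ∀ a b g00 g10 g20 g30 g01 g11 g21 g31 μ → (a * g00 + b * g01) * g21 + (a * g10 + b * g11) * g31 ≡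
                a * ((g00 * g21 + g10 * g31 - g20 * g01 - g30 * g11) - μ * 0ℤ) + g01 * (a * g20 + b * g21) + g11 * (a * g30 + b * g31)
              cert = solve-∀
      ωG₀w : p∣ (g₀₀ * w₂ + g₁₀ * w₃)
      ωG₀w = ∣-by (cert Kw.α Kw.β g₀₀ g₁₀ g₂₀ g₃₀ g₀₁ g₁₁ g₂₁ g₃₁ μ) (Kw.β ⊠ ω₀₁ ⊞ g₂₀ ⊠ Kw.first ⊞ g₃₀ ⊠ Kw.second)
        where cert : ∀ a b g00 g10 g20 g30 g01 g11 g21 g31 μ → g00 * (a * g20 + b * g21) + g10 * (a * g30 + b * g31) ≡
                b * ((g00 * g21 + g10 * g31 - g20 * g01 - g30 * g11) - μ * 0ℤ) + g20 * (a * g00 + b * g01) + g30 * (a * g10 + b * g11)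
              cert = solve-∀
      ωG₁w : p∣ (g₀₁ * w₂ + g₁₁ * w₃)
      ωG₁w = ∣-by (cert Kw.α Kw.β g₀₀ g₁₀ g₂₀ g₃₀ g₀₁ g₁₁ g₂₁ g₃₁ μ) ((- Kw.α) ⊠ ω₀₁ ⊞ g₂₁ ⊠ Kw.first ⊞ g₃₁ ⊠ Kw.second)
        where cert : ∀ a b g00 g10 g20 g30 g01 g11 g21 g31 μ → g01 * (a * g20 + b * g21) + g11 * (a * g30 + b * g31) ≡
                (- a) * ((g00 * g21 + g10 * g31 - g20 * g01 - g30 * g11) - μ * 0ℤ) + g21 * (a * g00 + b * g01) + g31 * (a * g10 + b * g11)
              cert = solve-∀
      ωtw : p∣ (t₀ * w₂ + t₁ * w₃)
      ωtw = ∣-by (cert t₀ t₁ Kw.α Kw.β g₂₀ g₂₁ g₃₀ g₃₁) (Kw.α ⊠ ωtG₀ ⊞ Kw.β ⊠ ωtG₁)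
        where cert : ∀ t₀ t₁ a b g20 g21 g30 g31 → t₀ * (a * g20 + b * g21) + t₁ * (a * g30 + b * g31) ≡
                a * (t₀ * g20 + t₁ * g30) + b * (t₀ * g21 + t₁ * g31)
              cert = solve-∀

    classify : FlagRepresentative G
    classify with p∣? bottom-minor | p∣? top-minor
    ... | inj₂ p∤Δ | _ = case-A p∤Δ
    ... | inj₁ p∣Δ | inj₂ p∤Δ′ = case-B p∣Δ p∤Δ′
    ... | inj₁ p∣Δ | inj₁ p∣Δ′ = case-D p∣Δ p∣Δ′

module CosetRepresentatives (p : ℕ) (p-prime : Prime p) (p-odd : ¬ (2 ∣ p)) (inv : ℕ → Seq)
  (inv-spec : ∀ l → 1 ≤ l → l < p → IsZp p (inv l) × ((nat l ⊗ inv l) ≈[ p ] I1)) where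
  open PAdicMatrices p
  open Cosets p p-prime
  open Representatives p p-prime p-odd inv inv-spec
  open Uniqueness p p-prime
  open Existence p p-prime

  rep-InK : (i : Idx p) → ValidIdx i → InK p (rep inv i)
  rep-InK i _ = GSp₄⇒InK (GSp₄-rep i)

  rep-complete : (g : Mat) → InK p g → Σ (Idx p) (λ i → ValidIdx i × InCoset p g (rep inv i))
  rep-complete g g∈K = i , valid , columns⇒InCoset (GSp₄-rep i) g g∈K a b c column₀ column₁
    where
    open KElement (InK⇒KElement {g} g∈K)
    representative = Classification.classify g (μ 1) (Unit⇒p∤ μ-unit) (ω-relation μ g similitude)
    i = proj₁ representative
    valid = proj₁ (proj₂ representative)
    open Refines (Refines-respʳ (rep-flag inv i) (proj₂ (proj₂ representative)))

  rep-injective : (i j : Idx p) → ValidIdx i → ValidIdx j → InCoset p (rep inv i) (rep inv j) → i ≡ j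
  rep-injective i j vi vj i∈jI = flag-injective i j vi vj
    (SameFlag-resp (rep-flag inv i) (rep-flag inv j) (InCoset⇒SameFlag {rep inv i} {rep inv j} i∈jI))

lemma3p1 : (p : ℕ) → Prime p → ¬ (2 ∣ p) →
    (inv : ℕ → Seq) →
    (∀ l → 1 ≤ l → l < p → IsZp p (inv l) × ((nat l ⊗ inv l) ≈[ p ] I1)) →
    ((i : Idx p) → ValidIdx i → InK p (rep inv i))
    × ((g : Mat) → InK p g → Σ (Idx p) (λ i → ValidIdx i × InCoset p g (rep inv i)))
    × ((i j : Idx p) → ValidIdx i → ValidIdx j → InCoset p (rep inv i) (rep inv j) → i ≡ j)
lemma3p1 p p-prime p-odd inv inv-spec = rep-InK , rep-complete , rep-injective
  where open CosetRepresentatives p p-prime p-odd inv inv-spec
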